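{- Let $p<q$ be primes. For every integer $k$ there is a polynomial $g(x)\in\mathbb Z[x]$ of degree less than $(p-1)(q-1)$, all of whose coefficients lie in $\{ -1,0,1\}$, such that $x^k\equiv g(x)\pmod{\Phi_{pq}(x)}$.
   Context: $\Phi_{pq}(x)$ is the $pq$th cyclotomic polynomial. For negative $k$, the congruence is understood in $\mathbb Z[x,x^{ -1}]$ (i.e. $\Phi_{pq}(x)$ divides $x^k-g(x)$ there). -}

module Defs where

open import Data.Nat as ℕ using (ℕ; zero; suc)
open import Data.Integer as ℤ using (ℤ; +_; -[1+_]; 0ℤ; 1ℤ)
open import Data.List using (List; []; _∷_; _++_; map; replicate; length; upTo; foldr)
open import Data.Product using (Σ; _×_; _,_)
open import Relation.Binary.PropositionalEquality using (_≡_)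

-- Polynomials in ℤ[x]: coefficient lists, lowest degree first.
-- Trailing zeros are allowed; equality is coefficientwise.
Poly : Set
Poly = List ℤ

coeff : Poly → ℕ → ℤ
coeff []      _       = 0ℤ
coeff (a ∷ f) zero    = a
coeff (a ∷ f) (suc n) = coeff f n

infix 4 _≈ₚ_
_≈ₚ_ : Poly → Poly → Set
f ≈ₚ g = ∀ n → coeff f n ≡ coeff g n

infixl 6 _+ₚ_ _-ₚ_
infixl 7 _*ₚ_

_+ₚ_ : Poly → Poly → Poly
[]      +ₚ g       = g
(a ∷ f) +ₚ []      = a ∷ f
(a ∷ f) +ₚ (b ∷ g) = (a ℤ.+ b) ∷ (f +ₚ g)

negₚ : Poly → Poly
negₚ = map (λ a → ℤ.- a)

_-ₚ_ : Poly → Poly → Poly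
f -ₚ g = f +ₚ negₚ g

scaleₚ : ℤ → Poly → Poly
scaleₚ a = map (a ℤ.*_)

_*ₚ_ : Poly → Poly → Poly
[]      *ₚ g = []
(a ∷ f) *ₚ g = scaleₚ a g +ₚ (0ℤ ∷ (f *ₚ g))

shiftₚ : ℕ → Poly → Poly
shiftₚ n f = replicate n 0ℤ ++ f

X^ : ℕ → Poly
X^ n = shiftₚ n (1ℤ ∷ [])

sumℤ : List ℤ → ℤ
sumℤ = foldr ℤ._+_ 0ℤ

-- Exact quotient of h by (x^m - 1), m ≥ 1, when (x^m - 1) divides h:
-- the quotient Q satisfies Q_n = Σ_{t ≥ 1} h_{n + t m} (long division from the top).
divXm1 : ℕ → Poly → Poly
divXm1 m h = map (λ n → sumℤ (map (λ t → coeff h (n ℕ.+ suc t ℕ.* m)) (upTo L))) (upTo L)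
  where L = length h

-- The pq-th cyclotomic polynomial for distinct primes p, q:
-- Φ_pq(x) = (x^{pq} - 1)(x - 1) / ((x^p - 1)(x^q - 1)).
Φpq : ℕ → ℕ → Poly
Φpq p q = divXm1 q (divXm1 p ((X^ (p ℕ.* q) -ₚ X^ 0) *ₚ (X^ 1 -ₚ X^ 0)))

-- Laurent polynomials ℤ[x, x⁻¹]: (m , f) represents x^{-m} f(x).
Laurent : Set
Laurent = ℕ × Poly

infix 4 _≈L_
_≈L_ : Laurent → Laurent → Set
(m , f) ≈L (n , g) = shiftₚ n f ≈ₚ shiftₚ m g

_*L_ : Laurent → Laurent → Laurent
(m , f) *L (n , g) = (m ℕ.+ n , f *ₚ g)

_-L_ : Laurent → Laurent → Laurent
(m , f) -L (n , g) = (m ℕ.+ n , shiftₚ n f -ₚ shiftₚ m g)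

polyL : Poly → Laurent
polyL f = (0 , f)

xpow : ℤ → Laurent
xpow (+ n)     = (0 , X^ n)
xpow -[1+ n ]  = (suc n , 1ℤ ∷ [])

_∣L_ : Laurent → Laurent → Set
a ∣L b = Σ Laurent (λ r → b ≈L a *L r)

{-# OPTIONS --safe #-}
-- Let S = pℕ + qℕ and χ its indicator. Since p and q are coprime, each n has at most one
-- representation n = i·p + j·q with i < q, so
--   (1 - x^pq) / ((1 - x^p)(1 - x^q)) = Σ_{i<q} x^(ip) / (1 - x^q) = Σ_{n ∈ S} x^n,
-- that is Φ_pq = (1 - x) Σ_{n ∈ S} x^n. Hence the coefficient of x^n in
-- Φ_pq · (x^c + ⋯ + x^(d-1)) is χ(n - c) - χ(n - d). As S contains every n ≥ N = (p-1)(q-1),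
-- a suitable such block Q makes x^k - Φ_pq · Q a polynomial supported below N with
-- coefficients in {-1, 0, 1}, for k in each of the ranges [-(p-1), 0), [0, N), [N, (p-1)q)
-- and [(p-1)q, (q-1)p]; these cover all residues mod pq, and Φ_pq divides x^pq - 1.

module Submission where

open import Defs
open import Data.Nat as ℕ using (ℕ; zero; suc; _+_; _*_; _∸_; _≤_; _<_; _≤?_; z≤n; s≤s; NonZero)
import Data.Nat.Properties as ℕP
open import Data.Integer as ℤ using (ℤ; +_; -[1+_]; 0ℤ; 1ℤ; -1ℤ)
  renaming (_+_ to _+ᶻ_; _-_ to _-ᶻ_; -_ to -ᶻ_; _*_ to _*ᶻ_)
import Data.Integer.Properties as ℤP
open import Data.Integer.DivMod using (_%ℕ_; _/ℕ_; a≡a%ℕn+[a/ℕn]*n; n%ℕd<d)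
open import Data.Integer.Tactic.RingSolver using (solve-∀)
open import Data.List using ([]; _∷_; map; length; applyUpTo)
open import Data.Vec using (Vec; toList) renaming ([] to []ᵛ; _∷_ to _∷ᵛ_)
open import Data.Vec.Relation.Unary.All using (All) renaming ([] to []ᵃ; _∷_ to _∷ᵃ_)
open import Data.Product using (Σ; ∃-syntax; _×_; _,_; proj₁; proj₂)
open import Data.Sum using (_⊎_; inj₁; inj₂)
open import Data.Empty using (⊥-elim)
open import Relation.Nullary using (Dec; yes; no; ¬_)
open import Relation.Nullary.Decidable using (_×-dec_)
open import Data.Nat.Divisibility using (_∣_; _∣?_; divides; _∣0; ∣-refl; ∣⇒≤; >⇒∤; ∣m+n∣m⇒∣n; ∣m∸n∣n⇒∣m; n∣m*n; m∣m*n)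
open import Data.Nat.DivMod using (_%_; _/_; m≡m%n+[m/n]*n; m%n<n)
open import Data.Nat.Primality using (Prime; euclidsLemma; ¬prime[0]; ¬prime[1])
open import Data.Nat.Coprimality using (prime⇒coprime; coprime-Bézout)
open import Data.Nat.GCD using (module Bézout)
import Data.Nat.Tactic.RingSolver as ℕ-Solver
open import Relation.Binary.PropositionalEquality

∑< : ℕ → (ℕ → ℤ) → ℤ
∑< zero    f = 0ℤ
∑< (suc m) f = f 0 +ᶻ ∑< m (λ i → f (suc i))

∑<-cong : ∀ m {f g : ℕ → ℤ} → (∀ i → i < m → f i ≡ g i) → ∑< m f ≡ ∑< m g
∑<-cong zero    eq = refl
∑<-cong (suc m) eq = cong₂ _+ᶻ_ (eq 0 (s≤s z≤n)) (∑<-cong m (λ i i<m → eq (suc i) (s≤s i<m)))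

∑<-zero : ∀ m f → (∀ i → i < m → f i ≡ 0ℤ) → ∑< m f ≡ 0ℤ
∑<-zero m f eq = trans (∑<-cong m eq) (∑<-0 m)
  where
  ∑<-0 : ∀ m → ∑< m (λ _ → 0ℤ) ≡ 0ℤ
  ∑<-0 zero    = refl
  ∑<-0 (suc m) = trans (ℤP.+-identityˡ _) (∑<-0 m)

∑<-suc : ∀ m f → ∑< (suc m) f ≡ ∑< m f +ᶻ f m
∑<-suc zero    f = ℤP.+-comm (f 0) 0ℤ
∑<-suc (suc m) f = trans (cong (f 0 +ᶻ_) (∑<-suc m (λ i → f (suc i))))
                         (sym (ℤP.+-assoc (f 0) _ _))

∑<-+ : ∀ m f g → ∑< m (λ i → f i +ᶻ g i) ≡ ∑< m f +ᶻ ∑< m g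
∑<-+ zero    f g = refl
∑<-+ (suc m) f g = trans (cong (f 0 +ᶻ g 0 +ᶻ_) (∑<-+ m _ _)) (interchange (f 0) (g 0) _ _)
  where
  interchange : ∀ a b c d → a +ᶻ b +ᶻ (c +ᶻ d) ≡ a +ᶻ c +ᶻ (b +ᶻ d)
  interchange = solve-∀

∑<-telescope : ∀ m (f : ℕ → ℤ) → ∑< m (λ i → f (suc i) -ᶻ f i) ≡ f m -ᶻ f 0
∑<-telescope zero    f = sym (ℤP.+-inverseʳ (f 0))
∑<-telescope (suc m) f = begin
  ∑< (suc m) (λ i → f (suc i) -ᶻ f i)       ≡⟨ ∑<-suc m _ ⟩
  ∑< m (λ i → f (suc i) -ᶻ f i) +ᶻ (f (suc m) -ᶻ f m) ≡⟨ cong (_+ᶻ (f (suc m) -ᶻ f m)) (∑<-telescope m f) ⟩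
  f m -ᶻ f 0 +ᶻ (f (suc m) -ᶻ f m)          ≡⟨ cancel (f 0) (f (suc m)) (f m) ⟩
  f (suc m) -ᶻ f 0                          ∎
  where
  open ≡-Reasoning
  cancel : ∀ a b c → c -ᶻ a +ᶻ (b -ᶻ c) ≡ b -ᶻ a
  cancel = solve-∀

δ : ℕ → ℕ → ℤ
δ zero    zero    = 1ℤ
δ zero    (suc n) = 0ℤ
δ (suc a) zero    = 0ℤ
δ (suc a) (suc n) = δ a n

δ-refl : ∀ a → δ a a ≡ 1ℤ
δ-refl zero    = refl
δ-refl (suc a) = δ-refl a

δ-≢ : ∀ a n → a ≢ n → δ a n ≡ 0ℤ
δ-≢ zero    zero    a≢n = ⊥-elim (a≢n refl)
δ-≢ zero    (suc n) a≢n = refl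
δ-≢ (suc a) zero    a≢n = refl
δ-≢ (suc a) (suc n) a≢n = δ-≢ a n (λ a≡n → a≢n (cong suc a≡n))

δ-0-> : ∀ n → 0 < n → δ 0 n ≡ 0ℤ
δ-0-> (suc n) _ = refl

δ-+ˡ : ∀ c a n → δ (c + a) (c + n) ≡ δ a n
δ-+ˡ zero    a n = refl
δ-+ˡ (suc c) a n = δ-+ˡ c a n

δ-+ʳ : ∀ a n c → δ (a + c) (n + c) ≡ δ a n
δ-+ʳ a n c = trans (cong₂ δ (ℕP.+-comm a c) (ℕP.+-comm n c)) (δ-+ˡ c a n)

shiftₛ : ℕ → (ℕ → ℤ) → ℕ → ℤ
shiftₛ zero    F n       = F n
shiftₛ (suc c) F zero    = 0ℤ
shiftₛ (suc c) F (suc n) = shiftₛ c F n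

shiftₛ-cong : ∀ c {F G : ℕ → ℤ} → (∀ i → F i ≡ G i) → ∀ n → shiftₛ c F n ≡ shiftₛ c G n
shiftₛ-cong zero    eq n       = eq n
shiftₛ-cong (suc c) eq zero    = refl
shiftₛ-cong (suc c) eq (suc n) = shiftₛ-cong c eq n

shiftₛ-+ : ∀ c F G n → shiftₛ c (λ i → F i +ᶻ G i) n ≡ shiftₛ c F n +ᶻ shiftₛ c G n
shiftₛ-+ zero    F G n       = refl
shiftₛ-+ (suc c) F G zero    = refl
shiftₛ-+ (suc c) F G (suc n) = shiftₛ-+ c F G n

shiftₛ-neg : ∀ c F n → shiftₛ c (λ i → -ᶻ F i) n ≡ -ᶻ shiftₛ c F n
shiftₛ-neg zero    F n       = refl
shiftₛ-neg (suc c) F zero    = refl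
shiftₛ-neg (suc c) F (suc n) = shiftₛ-neg c F n

shiftₛ-minus : ∀ c F G n → shiftₛ c (λ i → F i -ᶻ G i) n ≡ shiftₛ c F n -ᶻ shiftₛ c G n
shiftₛ-minus c F G n = trans (shiftₛ-+ c F (λ i → -ᶻ G i) n) (cong (shiftₛ c F n +ᶻ_) (shiftₛ-neg c G n))

shiftₛ-* : ∀ c a F n → shiftₛ c (λ i → a *ᶻ F i) n ≡ a *ᶻ shiftₛ c F n
shiftₛ-* zero    a F n       = refl
shiftₛ-* (suc c) a F zero    = sym (ℤP.*-zeroʳ a)
shiftₛ-* (suc c) a F (suc n) = shiftₛ-* c a F n

shiftₛ-0 : ∀ c n → shiftₛ c (λ _ → 0ℤ) n ≡ 0ℤ
shiftₛ-0 zero    n       = refl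
shiftₛ-0 (suc c) zero    = refl
shiftₛ-0 (suc c) (suc n) = shiftₛ-0 c n

shiftₛ-shiftₛ : ∀ a b F n → shiftₛ a (shiftₛ b F) n ≡ shiftₛ (a + b) F n
shiftₛ-shiftₛ zero    b F n       = refl
shiftₛ-shiftₛ (suc a) b F zero    = refl
shiftₛ-shiftₛ (suc a) b F (suc n) = shiftₛ-shiftₛ a b F n

shiftₛ-δ : ∀ c a n → shiftₛ c (δ a) n ≡ δ (c + a) n
shiftₛ-δ zero    a n       = refl
shiftₛ-δ (suc c) a zero    = refl
shiftₛ-δ (suc c) a (suc n) = shiftₛ-δ c a n

shiftₛ-< : ∀ c F n → n < c → shiftₛ c F n ≡ 0ℤ
shiftₛ-< (suc c) F zero    _         = refl
shiftₛ-< (suc c) F (suc n) (s≤s n<c) = shiftₛ-< c F n n<c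

shiftₛ-+ˡ : ∀ c F n → shiftₛ c F (c + n) ≡ F n
shiftₛ-+ˡ zero    F n = refl
shiftₛ-+ˡ (suc c) F n = shiftₛ-+ˡ c F n

shiftₛ-δ-shiftₛ : ∀ c a b G n → shiftₛ c (λ i → δ a i -ᶻ shiftₛ b G i) n ≡ δ (c + a) n -ᶻ shiftₛ (c + b) G n
shiftₛ-δ-shiftₛ c a b G n =
  trans (shiftₛ-minus c (δ a) (shiftₛ b G) n) (cong₂ _-ᶻ_ (shiftₛ-δ c a n) (shiftₛ-shiftₛ c b G n))

≤-indicator : ℕ → ℕ → ℤ
≤-indicator zero    n       = 1ℤ
≤-indicator (suc c) zero    = 0ℤ
≤-indicator (suc c) (suc n) = ≤-indicator c n

split-at : ∀ m (P : ℕ → Set) → (∀ n → n < m → P n) → (∀ e → P (m + e)) → ∀ n → P n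
split-at m P below above n with n ℕP.<? m
... | yes n<m = below n n<m
... | no  n≮m = subst P (ℕP.m+[n∸m]≡n (ℕP.≮⇒≥ n≮m)) (above (n ∸ m))

truncate : ℕ → (ℕ → ℤ) → ℕ → ℤ
truncate N F e with e ℕP.<? N
... | yes _ = F e
... | no  _ = 0ℤ

truncate-≥ : ∀ N F e → N ≤ e → truncate N F e ≡ 0ℤ
truncate-≥ N F e N≤e with e ℕP.<? N
... | yes e<N = ⊥-elim (ℕP.<⇒≱ e<N N≤e)
... | no  _   = refl

coeff-+ₚ : ∀ f g n → coeff (f +ₚ g) n ≡ coeff f n +ᶻ coeff g n
coeff-+ₚ []      g       n       = sym (ℤP.+-identityˡ _)
coeff-+ₚ (a ∷ f) []      n       = sym (ℤP.+-identityʳ _)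
coeff-+ₚ (a ∷ f) (b ∷ g) zero    = refl
coeff-+ₚ (a ∷ f) (b ∷ g) (suc n) = coeff-+ₚ f g n

coeff-map : ∀ (h : ℤ → ℤ) → h 0ℤ ≡ 0ℤ → ∀ f n → coeff (map h f) n ≡ h (coeff f n)
coeff-map h h0≡0 []      n       = sym h0≡0
coeff-map h h0≡0 (a ∷ f) zero    = refl
coeff-map h h0≡0 (a ∷ f) (suc n) = coeff-map h h0≡0 f n

coeff-negₚ : ∀ f n → coeff (negₚ f) n ≡ -ᶻ coeff f n
coeff-negₚ = coeff-map -ᶻ_ refl

coeff-minusₚ : ∀ f g n → coeff (f -ₚ g) n ≡ coeff f n -ᶻ coeff g n
coeff-minusₚ f g n = trans (coeff-+ₚ f (negₚ g) n) (cong (coeff f n +ᶻ_) (coeff-negₚ g n))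

coeff-shiftₚ : ∀ c f n → coeff (shiftₚ c f) n ≡ shiftₛ c (coeff f) n
coeff-shiftₚ zero    f n       = refl
coeff-shiftₚ (suc c) f zero    = refl
coeff-shiftₚ (suc c) f (suc n) = coeff-shiftₚ c f n

coeff-1 : ∀ n → coeff (1ℤ ∷ []) n ≡ δ 0 n
coeff-1 zero    = refl
coeff-1 (suc n) = refl

coeff-X^ : ∀ a n → coeff (X^ a) n ≡ δ a n
coeff-X^ a n = begin
  coeff (X^ a) n             ≡⟨ coeff-shiftₚ a (1ℤ ∷ []) n ⟩
  shiftₛ a (coeff (1ℤ ∷ [])) n ≡⟨ shiftₛ-cong a coeff-1 n ⟩
  shiftₛ a (δ 0) n           ≡⟨ shiftₛ-δ a 0 n ⟩
  δ (a + 0) n                ≡⟨ cong (λ b → δ b n) (ℕP.+-identityʳ a) ⟩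
  δ a n                      ∎
  where open ≡-Reasoning

coeff-≥-length : ∀ f n → length f ≤ n → coeff f n ≡ 0ℤ
coeff-≥-length []      n       _         = refl
coeff-≥-length (a ∷ f) (suc n) (s≤s len≤n) = coeff-≥-length f n len≤n

coeff-*ₚ-∷ : ∀ a f g n → coeff ((a ∷ f) *ₚ g) n ≡ a *ᶻ coeff g n +ᶻ shiftₛ 1 (coeff (f *ₚ g)) n
coeff-*ₚ-∷ a f g n = trans (coeff-+ₚ (scaleₚ a g) (0ℤ ∷ (f *ₚ g)) n)
                          (cong₂ _+ᶻ_ (coeff-map (a *ᶻ_) (ℤP.*-zeroʳ a) g n) (coeff-0∷ n))
  where
  coeff-0∷ : ∀ n → coeff (0ℤ ∷ (f *ₚ g)) n ≡ shiftₛ 1 (coeff (f *ₚ g)) n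
  coeff-0∷ zero    = refl
  coeff-0∷ (suc n) = refl

coeff-*ₚ-+ₚ : ∀ f g h n → coeff (f *ₚ (g +ₚ h)) n ≡ coeff (f *ₚ g) n +ᶻ coeff (f *ₚ h) n
coeff-*ₚ-+ₚ []      g h n = refl
coeff-*ₚ-+ₚ (a ∷ f) g h n = begin
  coeff ((a ∷ f) *ₚ (g +ₚ h)) n
    ≡⟨ coeff-*ₚ-∷ a f (g +ₚ h) n ⟩
  a *ᶻ coeff (g +ₚ h) n +ᶻ shiftₛ 1 (coeff (f *ₚ (g +ₚ h))) n
    ≡⟨ cong₂ _+ᶻ_ (cong (a *ᶻ_) (coeff-+ₚ g h n))
                  (trans (shiftₛ-cong 1 (coeff-*ₚ-+ₚ f g h) n) (shiftₛ-+ 1 _ _ n)) ⟩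
  a *ᶻ (coeff g n +ᶻ coeff h n) +ᶻ (shiftₛ 1 (coeff (f *ₚ g)) n +ᶻ shiftₛ 1 (coeff (f *ₚ h)) n)
    ≡⟨ distrib a (coeff g n) (coeff h n) _ _ ⟩
  (a *ᶻ coeff g n +ᶻ shiftₛ 1 (coeff (f *ₚ g)) n) +ᶻ (a *ᶻ coeff h n +ᶻ shiftₛ 1 (coeff (f *ₚ h)) n)
    ≡⟨ sym (cong₂ _+ᶻ_ (coeff-*ₚ-∷ a f g n) (coeff-*ₚ-∷ a f h n)) ⟩
  coeff ((a ∷ f) *ₚ g) n +ᶻ coeff ((a ∷ f) *ₚ h) n
    ∎
  where
  open ≡-Reasoning
  distrib : ∀ a x y u v → a *ᶻ (x +ᶻ y) +ᶻ (u +ᶻ v) ≡ a *ᶻ x +ᶻ u +ᶻ (a *ᶻ y +ᶻ v)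
  distrib = solve-∀

coeff-*ₚ-negₚ : ∀ f g n → coeff (f *ₚ negₚ g) n ≡ -ᶻ coeff (f *ₚ g) n
coeff-*ₚ-negₚ []      g n = refl
coeff-*ₚ-negₚ (a ∷ f) g n = begin
  coeff ((a ∷ f) *ₚ negₚ g) n
    ≡⟨ coeff-*ₚ-∷ a f (negₚ g) n ⟩
  a *ᶻ coeff (negₚ g) n +ᶻ shiftₛ 1 (coeff (f *ₚ negₚ g)) n
    ≡⟨ cong₂ _+ᶻ_ (cong (a *ᶻ_) (coeff-negₚ g n))
                  (trans (shiftₛ-cong 1 (coeff-*ₚ-negₚ f g) n) (shiftₛ-neg 1 _ n)) ⟩
  a *ᶻ (-ᶻ coeff g n) +ᶻ -ᶻ shiftₛ 1 (coeff (f *ₚ g)) n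
    ≡⟨ distrib a (coeff g n) _ ⟩
  -ᶻ (a *ᶻ coeff g n +ᶻ shiftₛ 1 (coeff (f *ₚ g)) n)
    ≡⟨ sym (cong -ᶻ_ (coeff-*ₚ-∷ a f g n)) ⟩
  -ᶻ coeff ((a ∷ f) *ₚ g) n
    ∎
  where
  open ≡-Reasoning
  distrib : ∀ a x u → a *ᶻ (-ᶻ x) +ᶻ (-ᶻ u) ≡ -ᶻ (a *ᶻ x +ᶻ u)
  distrib = solve-∀

coeff-*ₚ-minusₚ : ∀ f g h n → coeff (f *ₚ (g -ₚ h)) n ≡ coeff (f *ₚ g) n -ᶻ coeff (f *ₚ h) n
coeff-*ₚ-minusₚ f g h n =
  trans (coeff-*ₚ-+ₚ f g (negₚ h) n) (cong (coeff (f *ₚ g) n +ᶻ_) (coeff-*ₚ-negₚ f h n))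

coeff-*ₚ-shiftₚ : ∀ f c g n → coeff (f *ₚ shiftₚ c g) n ≡ shiftₛ c (coeff (f *ₚ g)) n
coeff-*ₚ-shiftₚ []      c g n = sym (shiftₛ-0 c n)
coeff-*ₚ-shiftₚ (a ∷ f) c g n = begin
  coeff ((a ∷ f) *ₚ shiftₚ c g) n
    ≡⟨ coeff-*ₚ-∷ a f (shiftₚ c g) n ⟩
  a *ᶻ coeff (shiftₚ c g) n +ᶻ shiftₛ 1 (coeff (f *ₚ shiftₚ c g)) n
    ≡⟨ cong₂ _+ᶻ_ (trans (cong (a *ᶻ_) (coeff-shiftₚ c g n)) (sym (shiftₛ-* c a (coeff g) n)))
                  (trans (shiftₛ-cong 1 (coeff-*ₚ-shiftₚ f c g) n) shifts-commute) ⟩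
  shiftₛ c (λ i → a *ᶻ coeff g i) n +ᶻ shiftₛ c (shiftₛ 1 (coeff (f *ₚ g))) n
    ≡⟨ sym (shiftₛ-+ c _ _ n) ⟩
  shiftₛ c (λ i → a *ᶻ coeff g i +ᶻ shiftₛ 1 (coeff (f *ₚ g)) i) n
    ≡⟨ sym (shiftₛ-cong c (coeff-*ₚ-∷ a f g) n) ⟩
  shiftₛ c (coeff ((a ∷ f) *ₚ g)) n
    ∎
  where
  open ≡-Reasoning
  shifts-commute : shiftₛ 1 (shiftₛ c (coeff (f *ₚ g))) n ≡ shiftₛ c (shiftₛ 1 (coeff (f *ₚ g))) n
  shifts-commute = trans (shiftₛ-shiftₛ 1 c _ n)
                  (trans (cong (λ b → shiftₛ b (coeff (f *ₚ g)) n) (ℕP.+-comm 1 c))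
                         (sym (shiftₛ-shiftₛ c 1 _ n)))

coeff-*ₚ-[] : ∀ f n → coeff (f *ₚ []) n ≡ 0ℤ
coeff-*ₚ-[] []      n = refl
coeff-*ₚ-[] (a ∷ f) n = trans (coeff-*ₚ-∷ a f [] n)
  (trans (cong₂ _+ᶻ_ (ℤP.*-zeroʳ a) (trans (shiftₛ-cong 1 (coeff-*ₚ-[] f) n) (shiftₛ-0 1 n)))
         (ℤP.+-identityˡ 0ℤ))

coeff-*ₚ-1 : ∀ f n → coeff (f *ₚ (1ℤ ∷ [])) n ≡ coeff f n
coeff-*ₚ-1 []      n       = refl
coeff-*ₚ-1 (a ∷ f) zero    =
  trans (coeff-*ₚ-∷ a f (1ℤ ∷ []) 0) (trans (ℤP.+-identityʳ _) (ℤP.*-identityʳ a))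
coeff-*ₚ-1 (a ∷ f) (suc n) =
  trans (coeff-*ₚ-∷ a f (1ℤ ∷ []) (suc n))
        (trans (cong (_+ᶻ coeff (f *ₚ (1ℤ ∷ [])) n) (ℤP.*-zeroʳ a))
               (trans (ℤP.+-identityˡ _) (coeff-*ₚ-1 f n)))

coeff-*ₚ-X^ : ∀ f a n → coeff (f *ₚ X^ a) n ≡ shiftₛ a (coeff f) n
coeff-*ₚ-X^ f a n = trans (coeff-*ₚ-shiftₚ f a (1ℤ ∷ []) n) (shiftₛ-cong a (coeff-*ₚ-1 f) n)

xpow-monomial : ∀ k → ∃[ j ] (+ j ≡ k +ᶻ + proj₁ (xpow k)) × (∀ n → coeff (proj₂ (xpow k)) n ≡ δ j n)
xpow-monomial (+ n)    = n , sym (ℤP.+-identityʳ (+ n)) , coeff-X^ n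
xpow-monomial -[1+ n ] = 0 , sym (ℤP.+-inverseˡ (+ suc n)) , coeff-1

tabulateℕ : (n : ℕ) → (ℕ → ℤ) → Vec ℤ n
tabulateℕ zero    G = []ᵛ
tabulateℕ (suc n) G = G 0 ∷ᵛ tabulateℕ n (λ i → G (suc i))

coeff-tabulateℕ-< : ∀ n G e → e < n → coeff (toList (tabulateℕ n G)) e ≡ G e
coeff-tabulateℕ-< (suc n) G zero    _         = refl
coeff-tabulateℕ-< (suc n) G (suc e) (s≤s e<n) = coeff-tabulateℕ-< n (λ i → G (suc i)) e e<n

coeff-tabulateℕ-≥ : ∀ n G e → n ≤ e → coeff (toList (tabulateℕ n G)) e ≡ 0ℤ
coeff-tabulateℕ-≥ zero    G e       _         = refl
coeff-tabulateℕ-≥ (suc n) G (suc e) (s≤s n≤e) = coeff-tabulateℕ-≥ n (λ i → G (suc i)) e n≤e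

All-tabulateℕ : ∀ {P : ℤ → Set} n G → (∀ e → P (G e)) → All P (tabulateℕ n G)
All-tabulateℕ zero    G PG = []ᵃ
All-tabulateℕ (suc n) G PG = PG 0 ∷ᵃ All-tabulateℕ n (λ i → G (suc i)) (λ e → PG (suc e))

blockₚ : ℕ → ℕ → Poly
blockₚ zero    zero    = []
blockₚ zero    (suc d) = 1ℤ ∷ blockₚ zero d
blockₚ (suc c) zero    = []
blockₚ (suc c) (suc d) = 0ℤ ∷ blockₚ c d

coeff-blockₚ : ∀ c d n → c ≤ d → coeff (blockₚ c d) n ≡ ≤-indicator c n -ᶻ ≤-indicator d n
coeff-blockₚ zero    zero    n       _         = refl
coeff-blockₚ zero    (suc d) zero    _         = refl
coeff-blockₚ zero    (suc d) (suc n) _         = coeff-blockₚ zero d n z≤n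
coeff-blockₚ (suc c) (suc d) zero    _         = refl
coeff-blockₚ (suc c) (suc d) (suc n) (s≤s c≤d) = coeff-blockₚ c d n c≤d

prefixSum : Poly → ℕ → ℤ
prefixSum f c = ∑< c (coeff f)

prefixSum-[] : ∀ c → prefixSum [] c ≡ 0ℤ
prefixSum-[] c = ∑<-zero c (coeff []) (λ _ _ → refl)

prefixSum-0∸ : ∀ f c → prefixSum f (0 ∸ c) ≡ 0ℤ
prefixSum-0∸ f c rewrite ℕP.0∸n≡0 c = refl

prefixSum-∷ : ∀ a f c m → prefixSum (a ∷ f) (suc m ∸ c) ≡ ≤-indicator c m *ᶻ a +ᶻ prefixSum f (m ∸ c)
prefixSum-∷ a f zero    m       = cong (_+ᶻ prefixSum f m) (sym (ℤP.*-identityˡ a))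
prefixSum-∷ a f (suc c) zero    rewrite ℕP.0∸n≡0 c = sym (ℤP.+-identityʳ (0ℤ *ᶻ a))
prefixSum-∷ a f (suc c) (suc m) = prefixSum-∷ a f c m

coeff-*ₚ-blockₚ : ∀ f c d n → c ≤ d →
                  coeff (f *ₚ blockₚ c d) n ≡ prefixSum f (suc n ∸ c) -ᶻ prefixSum f (suc n ∸ d)
coeff-*ₚ-blockₚ [] c d n _ rewrite prefixSum-[] (suc n ∸ c) | prefixSum-[] (suc n ∸ d) = refl
coeff-*ₚ-blockₚ (a ∷ f) c d n c≤d = begin
  coeff ((a ∷ f) *ₚ blockₚ c d) n
    ≡⟨ coeff-*ₚ-∷ a f (blockₚ c d) n ⟩
  a *ᶻ coeff (blockₚ c d) n +ᶻ shiftₛ 1 (coeff (f *ₚ blockₚ c d)) n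
    ≡⟨ cong₂ _+ᶻ_ (cong (a *ᶻ_) (coeff-blockₚ c d n c≤d)) (tail n) ⟩
  a *ᶻ (≤-indicator c n -ᶻ ≤-indicator d n) +ᶻ (prefixSum f (n ∸ c) -ᶻ prefixSum f (n ∸ d))
    ≡⟨ regroup a (≤-indicator c n) (≤-indicator d n) (prefixSum f (n ∸ c)) (prefixSum f (n ∸ d)) ⟩
  (≤-indicator c n *ᶻ a +ᶻ prefixSum f (n ∸ c)) -ᶻ (≤-indicator d n *ᶻ a +ᶻ prefixSum f (n ∸ d))
    ≡⟨ sym (cong₂ _-ᶻ_ (prefixSum-∷ a f c n) (prefixSum-∷ a f d n)) ⟩
  prefixSum (a ∷ f) (suc n ∸ c) -ᶻ prefixSum (a ∷ f) (suc n ∸ d)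
    ∎
  where
  open ≡-Reasoning
  regroup : ∀ a x y u v → a *ᶻ (x -ᶻ y) +ᶻ (u -ᶻ v) ≡ x *ᶻ a +ᶻ u -ᶻ (y *ᶻ a +ᶻ v)
  regroup = solve-∀
  tail : ∀ n → shiftₛ 1 (coeff (f *ₚ blockₚ c d)) n ≡ prefixSum f (n ∸ c) -ᶻ prefixSum f (n ∸ d)
  tail zero    rewrite prefixSum-0∸ f c | prefixSum-0∸ f d = refl
  tail (suc n) = coeff-*ₚ-blockₚ f c d n c≤d

-- Exact division by x^m - 1

sumℤ-map-applyUpTo : ∀ L (F : ℕ → ℤ) (g : ℕ → ℕ) → sumℤ (map F (applyUpTo g L)) ≡ ∑< L (λ t → F (g t))
sumℤ-map-applyUpTo zero    F g = refl
sumℤ-map-applyUpTo (suc L) F g = cong (F (g 0) +ᶻ_) (sumℤ-map-applyUpTo L F (λ t → g (suc t)))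

coeff-map-applyUpTo-< : ∀ L (F : ℕ → ℤ) (g : ℕ → ℕ) n → n < L → coeff (map F (applyUpTo g L)) n ≡ F (g n)
coeff-map-applyUpTo-< (suc L) F g zero    _         = refl
coeff-map-applyUpTo-< (suc L) F g (suc n) (s≤s n<L) =
  coeff-map-applyUpTo-< L F (λ t → g (suc t)) n n<L

coeff-map-applyUpTo-≥ : ∀ L (F : ℕ → ℤ) (g : ℕ → ℕ) n → L ≤ n → coeff (map F (applyUpTo g L)) n ≡ 0ℤ
coeff-map-applyUpTo-≥ zero    F g n       _         = refl
coeff-map-applyUpTo-≥ (suc L) F g (suc n) (s≤s L≤n) =
  coeff-map-applyUpTo-≥ L F (λ t → g (suc t)) n L≤n

coeff-divXm1-≥-length : ∀ m h n → length h ≤ n → coeff (divXm1 m h) n ≡ 0ℤ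
coeff-divXm1-≥-length m h n = coeff-map-applyUpTo-≥ (length h) _ (λ i → i) n

coeff-divXm1 : ∀ m h n → coeff (divXm1 m h) n ≡ ∑< (length h) (λ t → coeff h (n + suc t * m))
coeff-divXm1 m h n with n ℕP.<? length h
... | yes n<L = trans (coeff-map-applyUpTo-< (length h) _ (λ i → i) n n<L)
                      (sumℤ-map-applyUpTo (length h) _ (λ i → i))
... | no  n≮L = trans (coeff-divXm1-≥-length m h n L≤n)
                      (sym (∑<-zero (length h) _ (λ t _ → coeff-≥-length h _ (ℕP.≤-trans L≤n (ℕP.m≤m+n n _)))))
  where L≤n = ℕP.≮⇒≥ n≮L

coeff-divXm1-step : ∀ m' h n → let m = suc m' in
                    coeff (divXm1 m h) n ≡ coeff h (n + m) +ᶻ coeff (divXm1 m h) (n + m)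
coeff-divXm1-step m' h n = begin
  coeff (divXm1 m h) n
    ≡⟨ coeff-divXm1 m h n ⟩
  ∑< L φ
    ≡⟨ sym (ℤP.+-identityʳ _) ⟩
  ∑< L φ +ᶻ 0ℤ
    ≡⟨ cong (∑< L φ +ᶻ_) (sym φL≡0) ⟩
  ∑< L φ +ᶻ φ L
    ≡⟨ sym (∑<-suc L φ) ⟩
  φ 0 +ᶻ ∑< L (λ t → φ (suc t))
    ≡⟨ cong₂ _+ᶻ_ φ0 (∑<-cong L (λ t _ → φsuc t)) ⟩
  coeff h (n + m) +ᶻ ∑< L (λ t → coeff h (n + m + suc t * m))
    ≡⟨ cong (coeff h (n + m) +ᶻ_) (sym (coeff-divXm1 m h (n + m))) ⟩
  coeff h (n + m) +ᶻ coeff (divXm1 m h) (n + m)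
    ∎
  where
  open ≡-Reasoning
  m = suc m'
  L = length h
  φ : ℕ → ℤ
  φ t = coeff h (n + suc t * m)
  φL≡0 : φ L ≡ 0ℤ
  φL≡0 = coeff-≥-length h _ (ℕP.≤-trans (ℕP.m≤m*n L m) (ℕP.≤-trans (ℕP.m≤n+m (L * m) m) (ℕP.m≤n+m _ n)))
  φ0 : φ 0 ≡ coeff h (n + m)
  φ0 = cong (λ z → coeff h (n + z)) (ℕP.+-identityʳ m)
  φsuc : ∀ t → φ (suc t) ≡ coeff h (n + m + suc t * m)
  φsuc t = cong (coeff h) (sym (ℕP.+-assoc n m (suc t * m)))

coeff-divXm1-unique : ∀ m' h (F : ℕ → ℤ) → let m = suc m' in
                      (∀ n → F n ≡ coeff h (n + m) +ᶻ F (n + m)) →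
                      (B : ℕ) → (∀ n → B ≤ n → F n ≡ 0ℤ) →
                      ∀ n → coeff (divXm1 m h) n ≡ F n
coeff-divXm1-unique m' h F F-step B F-vanishes n =
  agree B' n (trans (coeff-divXm1-≥-length m h _ (ℕP.m+n≤o⇒m≤o (length h) B'≤))
                    (sym (F-vanishes _ (ℕP.m+n≤o⇒n≤o (length h) B'≤))))
  where
  m = suc m'
  Q = coeff (divXm1 m h)
  B' = length h + B
  B'≤ : B' ≤ n + B' * m
  B'≤ = ℕP.≤-trans (ℕP.m≤m*n B' m) (ℕP.m≤n+m _ n)
  agree : ∀ k n → Q (n + k * m) ≡ F (n + k * m) → Q n ≡ F n
  agree zero    n eq rewrite ℕP.+-identityʳ n = eq
  agree (suc k) n eq = begin
    Q n                         ≡⟨ coeff-divXm1-step m' h n ⟩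
    coeff h (n + m) +ᶻ Q (n + m) ≡⟨ cong (coeff h (n + m) +ᶻ_) (agree k (n + m) eq′) ⟩
    coeff h (n + m) +ᶻ F (n + m) ≡⟨ sym (F-step n) ⟩
    F n                         ∎
    where
    open ≡-Reasoning
    eq′ : Q (n + m + k * m) ≡ F (n + m + k * m)
    eq′ = subst (λ i → Q i ≡ F i) (sym (ℕP.+-assoc n m (k * m))) eq

Is01 : ℤ → Set
Is01 x = x ≡ 0ℤ ⊎ x ≡ 1ℤ

Is-101 : ℤ → Set
Is-101 x = x ≡ -1ℤ ⊎ x ≡ 0ℤ ⊎ x ≡ 1ℤ

AtMostOneOne : ℕ → (ℕ → ℤ) → Set
AtMostOneOne m f = ∀ i j → i < m → j < m → f i ≡ 1ℤ → f j ≡ 1ℤ → i ≡ j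

private
  others-zero : ∀ m f → (∀ i → Is01 (f i)) → AtMostOneOne (suc m) f → f m ≡ 1ℤ →
                ∀ i → i < m → f i ≡ 0ℤ
  others-zero m f f01 one fm≡1 i i<m with f01 i
  ... | inj₁ fi≡0 = fi≡0
  ... | inj₂ fi≡1 = ⊥-elim (ℕP.<-irrefl (one i m (ℕP.m≤n⇒m≤1+n i<m) ℕP.≤-refl fi≡1 fm≡1) i<m)

  AtMostOneOne-suc : ∀ m f → AtMostOneOne (suc m) f → AtMostOneOne m f
  AtMostOneOne-suc m f one i j i<m j<m = one i j (ℕP.m≤n⇒m≤1+n i<m) (ℕP.m≤n⇒m≤1+n j<m)

∑<-01 : ∀ m f → (∀ i → Is01 (f i)) → AtMostOneOne m f → Is01 (∑< m f)
∑<-01 zero    f f01 one = inj₁ refl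
∑<-01 (suc m) f f01 one rewrite ∑<-suc m f with f01 m
... | inj₁ fm≡0 rewrite fm≡0 | ℤP.+-identityʳ (∑< m f) = ∑<-01 m f f01 (AtMostOneOne-suc m f one)
... | inj₂ fm≡1 rewrite fm≡1 | ∑<-zero m f (others-zero m f f01 one fm≡1) = inj₂ refl

∑<-01-hit : ∀ m f → (∀ i → Is01 (f i)) → AtMostOneOne m f → ∀ j → j < m → f j ≡ 1ℤ → ∑< m f ≡ 1ℤ
∑<-01-hit (suc m) f f01 one j j<1+m fj≡1 rewrite ∑<-suc m f with ℕP.m<1+n⇒m<n∨m≡n j<1+m
... | inj₂ refl rewrite fj≡1 | ∑<-zero m f (others-zero m f f01 one fj≡1) = refl
... | inj₁ j<m with f01 m
...   | inj₁ fm≡0 rewrite fm≡0 | ∑<-01-hit m f f01 (AtMostOneOne-suc m f one) j j<m fj≡1 = refl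
...   | inj₂ fm≡1 = ⊥-elim (ℕP.<-irrefl (one j m j<1+m ℕP.≤-refl fj≡1 fm≡1) j<m)

Is-101-difference : ∀ {x y} → Is01 x → Is01 y → Is-101 (x -ᶻ y)
Is-101-difference (inj₁ refl) (inj₁ refl) = inj₂ (inj₁ refl)
Is-101-difference (inj₁ refl) (inj₂ refl) = inj₁ refl
Is-101-difference (inj₂ refl) (inj₁ refl) = inj₂ (inj₂ refl)
Is-101-difference (inj₂ refl) (inj₂ refl) = inj₂ (inj₁ refl)

δ-01 : ∀ a n → Is01 (δ a n)
δ-01 zero    zero    = inj₂ refl
δ-01 zero    (suc n) = inj₁ refl
δ-01 (suc a) zero    = inj₁ refl
δ-01 (suc a) (suc n) = δ-01 a n

𝟙 : {P : Set} → Dec P → ℤ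
𝟙 (yes _) = 1ℤ
𝟙 (no  _) = 0ℤ

𝟙-yes : ∀ {P : Set} (P? : Dec P) → P → 𝟙 P? ≡ 1ℤ
𝟙-yes (yes _) _  = refl
𝟙-yes (no ¬p) p  = ⊥-elim (¬p p)

𝟙-no : ∀ {P : Set} (P? : Dec P) → ¬ P → 𝟙 P? ≡ 0ℤ
𝟙-no (yes p) ¬p = ⊥-elim (¬p p)
𝟙-no (no _)  _  = refl

𝟙-sound : ∀ {P : Set} (P? : Dec P) → 𝟙 P? ≡ 1ℤ → P
𝟙-sound (yes p) _ = p

𝟙-01 : ∀ {P : Set} (P? : Dec P) → Is01 (𝟙 P?)
𝟙-01 (yes _) = inj₂ refl
𝟙-01 (no  _) = inj₁ refl

𝟙-⇔ : ∀ {P Q : Set} (P? : Dec P) (Q? : Dec Q) → (P → Q) → (Q → P) → 𝟙 P? ≡ 𝟙 Q?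
𝟙-⇔ (yes p) Q?      P⇒Q Q⇒P = sym (𝟙-yes Q? (P⇒Q p))
𝟙-⇔ (no ¬p) Q?      P⇒Q Q⇒P = sym (𝟙-no Q? (λ q → ¬p (Q⇒P q)))

∣m∣n⇒∣m∸n : ∀ {d m n} → n ≤ m → d ∣ m → d ∣ n → d ∣ m ∸ n
∣m∣n⇒∣m∸n n≤m d∣m d∣n = ∣m+n∣m⇒∣n (subst (_ ∣_) (sym (ℕP.m+[n∸m]≡n n≤m)) d∣m) d∣n

∸-swap : ∀ n a b → n ∸ a ∸ b ≡ n ∸ b ∸ a
∸-swap n a b = trans (ℕP.∸-+-assoc n a b) (trans (cong (n ∸_) (ℕP.+-comm a b)) (sym (ℕP.∸-+-assoc n b a)))

≡-mod⇒∣∸ : ∀ {a b} q C D → a + C * q ≡ b + D * q → a ≤ b → q ∣ b ∸ a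
≡-mod⇒∣∸ {a} {b} q C D eq a≤b = ∣m+n∣m⇒∣n (subst (q ∣_) Cq≡ (n∣m*n C)) (n∣m*n D)
  where
  Cq≡ : C * q ≡ D * q + (b ∸ a)
  Cq≡ = ℕP.+-cancelˡ-≡ a _ _ (begin
    a + C * q             ≡⟨ eq ⟩
    b + D * q             ≡⟨ cong (_+ D * q) (sym (ℕP.m+[n∸m]≡n a≤b)) ⟩
    a + (b ∸ a) + D * q   ≡⟨ ℕP.+-assoc a _ _ ⟩
    a + ((b ∸ a) + D * q) ≡⟨ cong (λ x → a + x) (ℕP.+-comm (b ∸ a) (D * q)) ⟩
    a + (D * q + (b ∸ a)) ∎)
    where open ≡-Reasoning

module Progression (q : ℕ) .{{_ : NonZero q}} where

  inProg : ℕ → ℕ → ℤ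
  inProg a n = 𝟙 (a ≤? n ×-dec q ∣? n ∸ a)

  inProg-1 : ∀ {a n} → a ≤ n → q ∣ n ∸ a → inProg a n ≡ 1ℤ
  inProg-1 a≤n q∣n∸a = 𝟙-yes _ (a≤n , q∣n∸a)

  inProg-> : ∀ {a n} → ¬ a ≤ n → inProg a n ≡ 0ℤ
  inProg-> a≰n = 𝟙-no _ (λ both → a≰n (proj₁ both))

  inProg-∤ : ∀ {a n} → ¬ q ∣ n ∸ a → inProg a n ≡ 0ℤ
  inProg-∤ q∤n∸a = 𝟙-no _ (λ both → q∤n∸a (proj₂ both))

  inProg-sound : ∀ a n → inProg a n ≡ 1ℤ → a ≤ n × q ∣ n ∸ a
  inProg-sound a n = 𝟙-sound _

  inProg-01 : ∀ a n → Is01 (inProg a n)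
  inProg-01 a n = 𝟙-01 _

  inProg-cong : ∀ {a n a' n'} → (a ≤ n → a' ≤ n') → (a' ≤ n' → a ≤ n) → n ∸ a ≡ n' ∸ a' →
                inProg a n ≡ inProg a' n'
  inProg-cong ⇒ ⇐ eq = 𝟙-⇔ _ _ (λ (l , d) → ⇒ l , subst (q ∣_) eq d)
                                 (λ (l , d) → ⇐ l , subst (q ∣_) (sym eq) d)

  inProg-+ : ∀ c a n → c ≤ n → inProg (c + a) n ≡ inProg a (n ∸ c)
  inProg-+ c a n c≤n = inProg-cong
    (λ c+a≤n → ℕP.m+n≤o⇒m≤o∸n a (subst (_≤ n) (ℕP.+-comm c a) c+a≤n))
    (λ a≤n∸c → subst (_≤ n) (ℕP.+-comm a c) (ℕP.m≤o∸n⇒m+n≤o a c≤n a≤n∸c))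
    (sym (ℕP.∸-+-assoc n c a))

  ∣∧<⇒≡0 : ∀ {k} → q ∣ k → k < q → k ≡ 0
  ∣∧<⇒≡0 {zero}  _   _   = refl
  ∣∧<⇒≡0 {suc k} q∣k k<q = ⊥-elim (>⇒∤ k<q q∣k)

  inProg-< : ∀ a n → n < q → inProg a n ≡ δ a n
  inProg-< a n n<q with a ℕ.≟ n
  ... | yes refl = trans (inProg-1 ℕP.≤-refl (subst (q ∣_) (sym (ℕP.n∸n≡0 a)) (q ∣0))) (sym (δ-refl a))
  ... | no  a≢n  = trans (𝟙-no _ (λ (a≤n , q∣n∸a) → a≢n (ℕP.≤-antisym a≤n
                           (ℕP.m∸n≡0⇒m≤n (∣∧<⇒≡0 q∣n∸a (ℕP.≤-<-trans (ℕP.m∸n≤m n a) n<q))))))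
                         (sym (δ-≢ a n a≢n))

  inProg-≥ : ∀ a n → q ≤ n → inProg a n ≡ δ a n +ᶻ inProg a (n ∸ q)
  inProg-≥ a n q≤n with a ℕ.≟ n
  ... | yes refl = trans (inProg-1 ℕP.≤-refl (subst (q ∣_) (sym (ℕP.n∸n≡0 a)) (q ∣0)))
                         (sym (cong₂ _+ᶻ_ (δ-refl a) (inProg-> (ℕP.<⇒≱ (ℕP.∸-monoʳ-< (ℕ.>-nonZero⁻¹ q) q≤n)))))
  ... | no  a≢n  = trans (𝟙-⇔ _ (a ≤? n ∸ q ×-dec q ∣? n ∸ q ∸ a) ⇒ ⇐)
                         (sym (trans (cong (_+ᶻ inProg a (n ∸ q)) (δ-≢ a n a≢n)) (ℤP.+-identityˡ _)))
    where
    ⇒ : a ≤ n × q ∣ n ∸ a → a ≤ n ∸ q × q ∣ n ∸ q ∸ a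
    ⇒ (a≤n , q∣n∸a) = ℕP.m+n≤o⇒m≤o∸n a (subst (_≤ n) (ℕP.+-comm q a) (ℕP.m≤o∸n⇒m+n≤o q a≤n q≤n∸a))
                    , subst (q ∣_) (∸-swap n a q) (∣m∣n⇒∣m∸n q≤n∸a q∣n∸a ∣-refl)
      where
      q≤n∸a : q ≤ n ∸ a
      q≤n∸a = ℕP.≮⇒≥ (λ n∸a<q → a≢n (ℕP.≤-antisym a≤n (ℕP.m∸n≡0⇒m≤n (∣∧<⇒≡0 q∣n∸a n∸a<q))))
    ⇐ : a ≤ n ∸ q × q ∣ n ∸ q ∸ a → a ≤ n × q ∣ n ∸ a
    ⇐ (a≤n∸q , q∣n∸q∸a) = ℕP.≤-trans a≤n∸q (ℕP.m∸n≤m n q)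
                         , ∣m∸n∣n⇒∣m q q≤n∸a (subst (q ∣_) (∸-swap n q a) q∣n∸q∸a) ∣-refl
      where
      q≤n∸a : q ≤ n ∸ a
      q≤n∸a = ℕP.m+n≤o⇒m≤o∸n q (subst (_≤ n) (ℕP.+-comm a q) (ℕP.m≤o∸n⇒m+n≤o a q≤n a≤n∸q))

module Cyclotomic (p-2 q-1 : ℕ) (p<q : suc (suc p-2) < suc q-1) (q-prime : Prime (suc q-1)) where

  p-1 p q N : ℕ
  p-1 = suc p-2
  p   = suc p-1
  q   = suc q-1
  N   = p-1 * q-1

  open Progression q

  -- The numerical semigroup pℕ + qℕ

  χ : ℕ → ℤ
  χ n = ∑< q (λ i → inProg (i * p) n)

  χ′ : ℕ → ℤ
  χ′ zero    = 0ℤ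
  χ′ (suc n) = χ n

  representation-unique : ∀ i j n → i ≤ j → j < q → i * p ≤ n → q ∣ n ∸ i * p →
                          j * p ≤ n → q ∣ n ∸ j * p → i ≡ j
  representation-unique i j n i≤j j<q ip≤n q∣n∸ip jp≤n q∣n∸jp with euclidsLemma (j ∸ i) p q-prime q∣[j∸i]p
    where
    ip≤jp = ℕP.*-monoˡ-≤ p i≤j
    q∣[j∸i]p : q ∣ (j ∸ i) * p
    q∣[j∸i]p = subst (q ∣_) (sym (ℕP.*-distribʳ-∸ p j i))
      (∣m+n∣m⇒∣n (subst (q ∣_) (split ip≤jp jp≤n) q∣n∸ip) q∣n∸jp)
      where
      split : ∀ {a b c} → a ≤ b → b ≤ c → c ∸ a ≡ (c ∸ b) + (b ∸ a)
      split {a} {b} {c} a≤b b≤c = trans (cong (_∸ a) (sym (ℕP.m∸n+n≡m b≤c))) (ℕP.+-∸-assoc (c ∸ b) a≤b)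
  ... | inj₁ q∣j∸i = ℕP.≤-antisym i≤j (ℕP.m∸n≡0⇒m≤n (∣∧<⇒≡0 q∣j∸i (ℕP.≤-<-trans (ℕP.m∸n≤m j i) j<q)))
  ... | inj₂ q∣p   = ⊥-elim (ℕP.<⇒≱ p<q (∣⇒≤ q∣p))

  χ-summands-unique : ∀ n → AtMostOneOne q (λ i → inProg (i * p) n)
  χ-summands-unique n i j i<q j<q hit-i hit-j
    with inProg-sound (i * p) n hit-i | inProg-sound (j * p) n hit-j | ℕP.≤-total i j
  ... | ip≤n , q∣i | jp≤n , q∣j | inj₁ i≤j = representation-unique i j n i≤j j<q ip≤n q∣i jp≤n q∣j
  ... | ip≤n , q∣i | jp≤n , q∣j | inj₂ j≤i = sym (representation-unique j i n j≤i i<q jp≤n q∣j ip≤n q∣i)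

  χ-01 : ∀ n → Is01 (χ n)
  χ-01 n = ∑<-01 q _ (λ i → inProg-01 (i * p) n) (χ-summands-unique n)

  χ′-01 : ∀ c → Is01 (χ′ c)
  χ′-01 zero    = inj₁ refl
  χ′-01 (suc n) = χ-01 n

  χ-hit : ∀ i n → i < q → inProg (i * p) n ≡ 1ℤ → χ n ≡ 1ℤ
  χ-hit i n i<q hit = ∑<-01-hit q _ (λ i → inProg-01 (i * p) n) (χ-summands-unique n) i i<q hit

  χ-0 : χ 0 ≡ 1ℤ
  χ-0 = χ-hit 0 0 (s≤s z≤n) (inProg-1 z≤n (q ∣0))

  χ-<p : ∀ n → 0 < n → n < p → χ n ≡ 0ℤ
  χ-<p n 0<n n<p = ∑<-zero q _ not-hit
    where
    not-hit : ∀ i → i < q → inProg (i * p) n ≡ 0ℤ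
    not-hit zero    _ = inProg-∤ (λ q∣n → ℕP.<⇒≱ (ℕP.<-trans n<p p<q) (∣⇒≤ q∣n))
      where instance _ = ℕ.>-nonZero 0<n
    not-hit (suc i) _ = inProg-> (λ ip≤n → ℕP.<⇒≱ n<p (ℕP.≤-trans (ℕP.m≤m+n p (i * p)) ip≤n))

  p-invertible-mod-q : ∃[ X ] ∃[ A ] ∃[ B ] X * p + A * q ≡ 1 + B * q
  p-invertible-mod-q with coprime-Bézout (prime⇒coprime q-prime p<q)
  ... | Bézout.-+ x y 1+xq≡yp = y , 0 , x , trans (ℕP.+-identityʳ (y * p)) (sym 1+xq≡yp)
  ... | Bézout.+- x y 1+yp≡xq = q-1 * y , 1 , q-1 * x , (begin
    q-1 * y * p + 1 * q     ≡⟨ expand q-1 y p ⟩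
    1 + q-1 * (1 + y * p)   ≡⟨ cong (λ z → 1 + q-1 * z) 1+yp≡xq ⟩
    1 + q-1 * (x * q)       ≡⟨ regroup q-1 x q ⟩
    1 + q-1 * x * q         ∎)
    where
    open ≡-Reasoning
    expand : ∀ q-1 y p → q-1 * y * p + 1 * (1 + q-1) ≡ 1 + q-1 * (1 + y * p)
    expand = ℕ-Solver.solve-∀
    regroup : ∀ q-1 x q → 1 + q-1 * (x * q) ≡ 1 + q-1 * x * q
    regroup = ℕ-Solver.solve-∀

  p-multiple-≡-mod-q : ∀ n → ∃[ i ] i < q × ∃[ C ] ∃[ D ] i * p + C * q ≡ n + D * q
  p-multiple-≡-mod-q n with p-invertible-mod-q
  ... | X , A , B , Xp+Aq≡1+Bq = i , m%n<n (n * X) q , c * p + n * A , n * B , (begin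
    i * p + (c * p + n * A) * q ≡⟨ regroup i p c n A q ⟩
    (i + c * q) * p + n * A * q ≡⟨ cong (λ z → z * p + n * A * q) (sym (m≡m%n+[m/n]*n (n * X) q)) ⟩
    n * X * p + n * A * q       ≡⟨ factor n X p A q ⟩
    n * (X * p + A * q)         ≡⟨ cong (n *_) Xp+Aq≡1+Bq ⟩
    n * (1 + B * q)             ≡⟨ expand n B q ⟩
    n + n * B * q               ∎)
    where
    open ≡-Reasoning
    i = (n * X) % q
    c = (n * X) / q
    regroup : ∀ i p c n A q → i * p + (c * p + n * A) * q ≡ (i + c * q) * p + n * A * q
    regroup = ℕ-Solver.solve-∀
    factor : ∀ n X p A q → n * X * p + n * A * q ≡ n * (X * p + A * q)
    factor = ℕ-Solver.solve-∀
    expand : ∀ n B q → n * (1 + B * q) ≡ n + n * B * q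
    expand = ℕ-Solver.solve-∀

  -- (p-1)(q-1) is the conductor of pℕ + qℕ: if i·p ≡ n (mod q) with i < q but i·p > n,
  -- then n ≤ i·p - q ≤ (q-1)p - q = N - 1.
  χ-≥N : ∀ n → N ≤ n → χ n ≡ 1ℤ
  χ-≥N n N≤n = from-residue (p-multiple-≡-mod-q n)
    where
    sizes : ∀ q-1 p-2 → 1 + q-1 * (2 + p-2) ≡ (1 + p-2) * q-1 + (1 + q-1)
    sizes = ℕ-Solver.solve-∀
    from-residue : ∃[ i ] i < q × ∃[ C ] ∃[ D ] i * p + C * q ≡ n + D * q → χ n ≡ 1ℤ
    from-residue (i , i<q , C , D , ip+Cq≡n+Dq) with i * p ≤? n
    ... | yes ip≤n = χ-hit i n i<q (inProg-1 ip≤n (≡-mod⇒∣∸ q C D ip+Cq≡n+Dq ip≤n))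
    ... | no  ip≰n = ⊥-elim (ℕP.<-irrefl refl (ℕP.≤-trans (ℕP.≤-reflexive (sizes q-1 p-2)) N+q≤[q-1]p))
      where
      n<ip : n < i * p
      n<ip = ℕP.≰⇒> ip≰n
      q≤ip∸n : q ≤ i * p ∸ n
      q≤ip∸n = ℕP.≮⇒≥ (λ ip∸n<q → ℕP.m>n⇒m∸n≢0 n<ip (∣∧<⇒≡0 (≡-mod⇒∣∸ q D C (sym ip+Cq≡n+Dq) (ℕP.<⇒≤ n<ip)) ip∸n<q))
      N+q≤[q-1]p : N + q ≤ q-1 * p
      N+q≤[q-1]p = begin
        N + q   ≤⟨ ℕP.+-monoˡ-≤ q N≤n ⟩
        n + q   ≡⟨ ℕP.+-comm n q ⟩
        q + n   ≤⟨ ℕP.m≤o∸n⇒m+n≤o q (ℕP.<⇒≤ n<ip) q≤ip∸n ⟩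
        i * p   ≤⟨ ℕP.*-monoˡ-≤ p (ℕP.≤-pred i<q) ⟩
        q-1 * p ∎
        where open ℕP.≤-Reasoning

  multP : ℕ → ℤ
  multP n = ∑< q (λ i → δ (i * p) n)

  -- [q ∣ n and n < pq]
  multQ : ℕ → ℤ
  multQ n = inProg 0 n -ᶻ inProg (q * p) n

  χ′-∸q : ∀ c → χ′ c -ᶻ χ′ (c ∸ q) ≡ shiftₛ 1 multP c
  χ′-∸q zero rewrite ℕP.0∸n≡0 q = refl
  χ′-∸q (suc n) with n ℕP.<? q
  ... | yes n<q rewrite ℕP.m≤n⇒m∸n≡0 n<q =
    trans (ℤP.+-identityʳ (χ n)) (∑<-cong q (λ i _ → inProg-< (i * p) n n<q))
  ... | no  n≮q rewrite ℕP.+-∸-assoc 1 (ℕP.≮⇒≥ n≮q) = begin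
    χ n -ᶻ χ (n ∸ q)
      ≡⟨ cong (_-ᶻ χ (n ∸ q)) (∑<-cong q (λ i _ → inProg-≥ (i * p) n q≤n)) ⟩
    ∑< q (λ i → δ (i * p) n +ᶻ inProg (i * p) (n ∸ q)) -ᶻ χ (n ∸ q)
      ≡⟨ cong (_-ᶻ χ (n ∸ q)) (∑<-+ q (λ i → δ (i * p) n) (λ i → inProg (i * p) (n ∸ q))) ⟩
    multP n +ᶻ χ (n ∸ q) -ᶻ χ (n ∸ q)
      ≡⟨ cancel (multP n) (χ (n ∸ q)) ⟩
    multP n
      ∎
    where
    open ≡-Reasoning
    q≤n = ℕP.≮⇒≥ n≮q
    cancel : ∀ t s → t +ᶻ s -ᶻ s ≡ t
    cancel = solve-∀

  χ′-∸p : ∀ c → χ′ c -ᶻ χ′ (c ∸ p) ≡ shiftₛ 1 multQ c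
  χ′-∸p zero rewrite ℕP.0∸n≡0 p = refl
  χ′-∸p (suc n) with n ℕP.<? p
  ... | yes n<p rewrite ℕP.m≤n⇒m∸n≡0 n<p = begin
    χ n -ᶻ 0ℤ
      ≡⟨ ℤP.+-identityʳ (χ n) ⟩
    inProg 0 n +ᶻ ∑< q-1 (λ i → inProg (p + i * p) n)
      ≡⟨ cong (inProg 0 n +ᶻ_) (∑<-zero q-1 _ (λ i _ → beyond (i * p))) ⟩
    inProg 0 n -ᶻ 0ℤ
      ≡⟨ cong (λ x → inProg 0 n -ᶻ x) (sym (beyond (q-1 * p))) ⟩
    multQ n
      ∎
    where
    open ≡-Reasoning
    beyond : ∀ a → inProg (p + a) n ≡ 0ℤ
    beyond a = inProg-> (λ p+a≤n → ℕP.<⇒≱ n<p (ℕP.≤-trans (ℕP.m≤m+n p a) p+a≤n))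
  ... | no  n≮p rewrite ℕP.+-∸-assoc 1 (ℕP.≮⇒≥ n≮p) = begin
    χ n -ᶻ χ (n ∸ p)
      ≡⟨ cong₂ _-ᶻ_ (cong (inProg 0 n +ᶻ_) (∑<-cong q-1 (λ i _ → inProg-+ p (i * p) n p≤n)))
                    (trans (∑<-suc q-1 _) (cong (S +ᶻ_) (sym (inProg-+ p (q-1 * p) n p≤n)))) ⟩
    inProg 0 n +ᶻ S -ᶻ (S +ᶻ inProg (q * p) n)
      ≡⟨ cancel (inProg 0 n) S (inProg (q * p) n) ⟩
    multQ n
      ∎
    where
    open ≡-Reasoning
    p≤n = ℕP.≮⇒≥ n≮p
    S = ∑< q-1 (λ i → inProg (i * p) (n ∸ p))
    cancel : ∀ x s y → x +ᶻ s -ᶻ (s +ᶻ y) ≡ x -ᶻ y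
    cancel = solve-∀

  multP-+p : ∀ j → multP (j + p) ≡ multP j -ᶻ δ (q-1 * p) j
  multP-+p j = begin
    δ 0 (j + p) +ᶻ ∑< q-1 (λ i → δ (p + i * p) (j + p))
      ≡⟨ cong₂ _+ᶻ_ (δ-0-> (j + p) (ℕP.≤-trans (s≤s z≤n) (ℕP.m≤n+m p j)))
                    (∑<-cong q-1 (λ i _ → trans (cong (δ (p + i * p)) (ℕP.+-comm j p)) (δ-+ˡ p (i * p) j))) ⟩
    0ℤ +ᶻ ∑< q-1 (λ i → δ (i * p) j)
      ≡⟨ ℤP.+-identityˡ _ ⟩
    ∑< q-1 (λ i → δ (i * p) j)
      ≡⟨ sym (cancel (∑< q-1 (λ i → δ (i * p) j)) (δ (q-1 * p) j)) ⟩
    ∑< q-1 (λ i → δ (i * p) j) +ᶻ δ (q-1 * p) j -ᶻ δ (q-1 * p) j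
      ≡⟨ cong (_-ᶻ δ (q-1 * p) j) (sym (∑<-suc q-1 (λ i → δ (i * p) j))) ⟩
    multP j -ᶻ δ (q-1 * p) j
      ∎
    where
    open ≡-Reasoning
    cancel : ∀ t s → t +ᶻ s -ᶻ s ≡ t
    cancel = solve-∀

  multP-<p : ∀ n → n < p → multP n ≡ δ 0 n
  multP-<p n n<p = trans (cong (δ 0 n +ᶻ_) (∑<-zero q-1 _ (λ i _ → δ-≢ (p + i * p) n (λ p+ip≡n →
                           ℕP.<⇒≱ n<p (ℕP.≤-trans (ℕP.m≤m+n p (i * p)) (ℕP.≤-reflexive p+ip≡n))))))
                         (ℤP.+-identityʳ _)

  multP->[q-1]p : ∀ n → q-1 * p < n → multP n ≡ 0ℤ
  multP->[q-1]p n [q-1]p<n = ∑<-zero q _ (λ i i<q → δ-≢ (i * p) n (λ ip≡n →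
    ℕP.<⇒≱ [q-1]p<n (ℕP.≤-trans (ℕP.≤-reflexive (sym ip≡n)) (ℕP.*-monoˡ-≤ p (ℕP.≤-pred i<q)))))

  inProg-qp⇒q∣ : ∀ n → inProg (q * p) n ≡ 1ℤ → q ∣ n
  inProg-qp⇒q∣ n hit with inProg-sound (q * p) n hit
  ... | qp≤n , q∣n∸qp = ∣m∸n∣n⇒∣m q qp≤n q∣n∸qp (m∣m*n p)

  multQ-01 : ∀ n → Is01 (multQ n)
  multQ-01 n with inProg-01 (q * p) n
  ... | inj₁ miss rewrite miss = subst Is01 (sym (ℤP.+-identityʳ _)) (inProg-01 0 n)
  ... | inj₂ hit  rewrite hit | inProg-1 {0} {n} z≤n (inProg-qp⇒q∣ n hit) = inj₁ refl

  -- beyond (p-2)q the only multiple of q below pq is (p-1)q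
  multQ-late : ∀ j → suc (p-2 * q) ≤ j → multQ j ≡ δ (p-1 * q) j
  multQ-late j late = by-divisibility (q ∣? j)
    where
    [qp]≡0 : ¬ q ∣ j → inProg (q * p) j ≡ 0ℤ
    [qp]≡0 q∤j with inProg-01 (q * p) j
    ... | inj₁ miss = miss
    ... | inj₂ hit  = ⊥-elim (q∤j (inProg-qp⇒q∣ j hit))
    by-size : q ∣ j → Dec (q * p ≤ j) → multQ j ≡ δ (p-1 * q) j
    by-size q∣j (yes qp≤j) =
      trans (cong₂ _-ᶻ_ (inProg-1 {0} {j} z≤n q∣j) (inProg-1 qp≤j (∣m∣n⇒∣m∸n qp≤j q∣j (m∣m*n p))))
            (sym (δ-≢ (p-1 * q) j (λ eq → ℕP.<⇒≱ [p-1]q<j (ℕP.≤-reflexive (sym eq)))))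
      where
      [p-1]q<j : p-1 * q < j
      [p-1]q<j = ℕP.<-≤-trans (subst (p-1 * q <_) (ℕP.*-comm p q) (ℕP.*-monoˡ-< q (ℕP.n<1+n p-1))) qp≤j
    by-size q∣j@(divides t j≡tq) (no qp≰j) =
      trans (cong₂ _-ᶻ_ (inProg-1 {0} {j} z≤n q∣j) (inProg-> qp≰j))
            (sym (subst (λ z → δ (p-1 * q) z ≡ 1ℤ) (sym j≡[p-1]q) (δ-refl (p-1 * q))))
      where
      t<p : t < p
      t<p = ℕP.*-cancelʳ-< q t p (subst₂ _<_ j≡tq (ℕP.*-comm q p) (ℕP.≰⇒> qp≰j))
      p-2<t : p-2 < t
      p-2<t = ℕP.*-cancelʳ-< q p-2 t (subst (p-2 * q <_) j≡tq late)
      j≡[p-1]q : j ≡ p-1 * q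
      j≡[p-1]q = trans j≡tq (cong (_* q) (ℕP.≤-antisym (ℕP.≤-pred t<p) p-2<t))
    by-divisibility : Dec (q ∣ j) → multQ j ≡ δ (p-1 * q) j
    by-divisibility (yes q∣j) = by-size q∣j (q * p ≤? j)
    by-divisibility (no  q∤j) = trans (cong₂ _-ᶻ_ (inProg-∤ {0} {j} q∤j) ([qp]≡0 q∤j))
                                      (sym (δ-≢ (p-1 * q) j (λ eq → q∤j (subst (q ∣_) eq (n∣m*n p-1)))))

  -- The coefficients of Φ_pq

  Xpq-1 : Poly
  Xpq-1 = X^ (p * q) -ₚ X^ 0

  numerator : Poly
  numerator = Xpq-1 *ₚ (X^ 1 -ₚ X^ 0)

  pq≡[q-1]p+p : p * q ≡ q-1 * p + p
  pq≡[q-1]p+p = commute p q-1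
    where
    commute : ∀ p q-1 → p * (1 + q-1) ≡ q-1 * p + p
    commute = ℕ-Solver.solve-∀

  δpq-δ0-+p : ∀ n → δ (p * q) (n + p) -ᶻ δ 0 (n + p) ≡ δ (q-1 * p) n
  δpq-δ0-+p n = begin
    δ (p * q) (n + p) -ᶻ δ 0 (n + p)
      ≡⟨ cong₂ _-ᶻ_ (cong (λ a → δ a (n + p)) pq≡[q-1]p+p) (δ-0-> (n + p) (ℕP.≤-trans (s≤s z≤n) (ℕP.m≤n+m p n))) ⟩
    δ (q-1 * p + p) (n + p) -ᶻ 0ℤ
      ≡⟨ trans (ℤP.+-identityʳ _) (δ-+ʳ (q-1 * p) n p) ⟩
    δ (q-1 * p) n
      ∎
    where open ≡-Reasoning

  coeff-Xpq-1 : ∀ n → coeff Xpq-1 n ≡ δ (p * q) n -ᶻ δ 0 n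
  coeff-Xpq-1 n = trans (coeff-minusₚ (X^ (p * q)) (X^ 0) n) (cong₂ _-ᶻ_ (coeff-X^ (p * q) n) (coeff-X^ 0 n))

  coeff-Xpq-1-p-1 : coeff Xpq-1 p-1 ≡ 0ℤ
  coeff-Xpq-1-p-1 = trans (coeff-Xpq-1 p-1)
    (cong (_-ᶻ 0ℤ) (δ-≢ (p * q) p-1 (λ pq≡p-1 → ℕP.<⇒≱ (ℕP.n<1+n p-1) (subst (p ≤_) pq≡p-1 (ℕP.m≤m*n p q)))))

  coeff-numerator-+p : ∀ n → coeff numerator (n + p) ≡ shiftₛ 1 (δ (q-1 * p)) n -ᶻ δ (q-1 * p) n
  coeff-numerator-+p n = begin
    coeff numerator (n + p)
      ≡⟨ coeff-*ₚ-minusₚ Xpq-1 (X^ 1) (X^ 0) (n + p) ⟩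
    coeff (Xpq-1 *ₚ X^ 1) (n + p) -ᶻ coeff (Xpq-1 *ₚ X^ 0) (n + p)
      ≡⟨ cong₂ _-ᶻ_ (trans (coeff-*ₚ-X^ Xpq-1 1 (n + p)) (shifted n))
                    (trans (coeff-*ₚ-X^ Xpq-1 0 (n + p)) (trans (coeff-Xpq-1 (n + p)) (δpq-δ0-+p n))) ⟩
    shiftₛ 1 (δ (q-1 * p)) n -ᶻ δ (q-1 * p) n
      ∎
    where
    open ≡-Reasoning
    shifted : ∀ n → shiftₛ 1 (coeff Xpq-1) (n + p) ≡ shiftₛ 1 (δ (q-1 * p)) n
    shifted zero    = coeff-Xpq-1-p-1
    shifted (suc n) = trans (coeff-Xpq-1 (n + p)) (δpq-δ0-+p n)

  quotientP : Poly
  quotientP = divXm1 p numerator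

  coeff-quotientP : ∀ n → coeff quotientP n ≡ shiftₛ 1 multP n -ᶻ multP n
  coeff-quotientP = coeff-divXm1-unique p-1 numerator E E-step (suc (suc (q-1 * p))) E-vanishes
    where
    E : ℕ → ℤ
    E n = shiftₛ 1 multP n -ᶻ multP n
    multP-+p-1 : ∀ n → multP (n + p-1) ≡ shiftₛ 1 multP n -ᶻ shiftₛ 1 (δ (q-1 * p)) n
    multP-+p-1 zero    = multP-<p p-1 (ℕP.n<1+n p-1)
    multP-+p-1 (suc n) = trans (cong multP (sym (ℕP.+-suc n p-1))) (multP-+p n)
    E-step : ∀ n → E n ≡ coeff numerator (n + p) +ᶻ E (n + p)
    E-step n = begin
      shiftₛ 1 multP n -ᶻ multP n
        ≡⟨ regroup (shiftₛ 1 multP n) (multP n) (shiftₛ 1 (δ (q-1 * p)) n) (δ (q-1 * p) n) ⟩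
      (s -ᶻ d) +ᶻ ((shiftₛ 1 multP n -ᶻ s) -ᶻ (multP n -ᶻ d))
        ≡⟨ sym (cong₂ _+ᶻ_ (coeff-numerator-+p n) (cong₂ _-ᶻ_ shifted (multP-+p n))) ⟩
      coeff numerator (n + p) +ᶻ E (n + p)
        ∎
      where
      open ≡-Reasoning
      s = shiftₛ 1 (δ (q-1 * p)) n
      d = δ (q-1 * p) n
      shifted : shiftₛ 1 multP (n + p) ≡ shiftₛ 1 multP n -ᶻ s
      shifted = trans (cong (shiftₛ 1 multP) (ℕP.+-suc n p-1)) (multP-+p-1 n)
      regroup : ∀ a t s d → a -ᶻ t ≡ (s -ᶻ d) +ᶻ ((a -ᶻ s) -ᶻ (t -ᶻ d))
      regroup = solve-∀
    E-vanishes : ∀ n → suc (suc (q-1 * p)) ≤ n → E n ≡ 0ℤ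
    E-vanishes (suc n) (s≤s [q-1]p<n) =
      cong₂ _-ᶻ_ (multP->[q-1]p n [q-1]p<n) (multP->[q-1]p (suc n) (ℕP.m≤n⇒m≤1+n [q-1]p<n))

  χ′-+q : ∀ c → χ′ (c + q) ≡ χ′ c +ᶻ shiftₛ 1 multP (c + q)
  χ′-+q c = begin
    χ′ (c + q)                               ≡⟨ sym (ℤP.+-identityˡ _) ⟩
    0ℤ +ᶻ χ′ (c + q)                         ≡⟨ cong (_+ᶻ χ′ (c + q)) (sym (ℤP.+-inverseʳ (χ′ c))) ⟩
    χ′ c -ᶻ χ′ c +ᶻ χ′ (c + q)                ≡⟨ regroup (χ′ c) (χ′ (c + q)) ⟩
    χ′ c +ᶻ (χ′ (c + q) -ᶻ χ′ c)              ≡⟨ cong (λ c′ → χ′ c +ᶻ (χ′ (c + q) -ᶻ χ′ c′)) (sym (ℕP.m+n∸n≡m c q)) ⟩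
    χ′ c +ᶻ (χ′ (c + q) -ᶻ χ′ (c + q ∸ q))    ≡⟨ cong (χ′ c +ᶻ_) (χ′-∸q (c + q)) ⟩
    χ′ c +ᶻ shiftₛ 1 multP (c + q)            ∎
    where
    open ≡-Reasoning
    regroup : ∀ a b → a -ᶻ a +ᶻ b ≡ a +ᶻ (b -ᶻ a)
    regroup = solve-∀

  Φ : Poly
  Φ = Φpq p q

  coeff-Φ : ∀ n → coeff Φ n ≡ χ′ (suc n) -ᶻ χ′ n
  coeff-Φ = coeff-divXm1-unique q-1 quotientP F F-step (suc N) F-vanishes
    where
    F : ℕ → ℤ
    F n = χ′ (suc n) -ᶻ χ′ n
    F-step : ∀ n → F n ≡ coeff quotientP (n + q) +ᶻ F (n + q)
    F-step n = begin
      χ′ (suc n) -ᶻ χ′ n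
        ≡⟨ regroup (χ′ (suc n)) (χ′ n) (multP (n + q)) (shiftₛ 1 multP (n + q)) ⟩
      (shiftₛ 1 multP (n + q) -ᶻ multP (n + q)) +ᶻ
        ((χ′ (suc n) +ᶻ multP (n + q)) -ᶻ (χ′ n +ᶻ shiftₛ 1 multP (n + q)))
        ≡⟨ sym (cong₂ _+ᶻ_ (coeff-quotientP (n + q)) (cong₂ _-ᶻ_ (χ′-+q (suc n)) (χ′-+q n))) ⟩
      coeff quotientP (n + q) +ᶻ F (n + q)
        ∎
      where
      open ≡-Reasoning
      regroup : ∀ a b t s → a -ᶻ b ≡ (s -ᶻ t) +ᶻ ((a +ᶻ t) -ᶻ (b +ᶻ s))
      regroup = solve-∀
    F-vanishes : ∀ n → suc N ≤ n → F n ≡ 0ℤ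
    F-vanishes (suc n) (s≤s N≤n) =
      trans (cong₂ _-ᶻ_ (χ-≥N (suc n) (ℕP.m≤n⇒m≤1+n N≤n)) (χ-≥N n N≤n)) (ℤP.+-inverseʳ 1ℤ)

  prefixSum-Φ : ∀ c → prefixSum Φ c ≡ χ′ c
  prefixSum-Φ c = trans (∑<-cong c (λ i _ → coeff-Φ i)) (trans (∑<-telescope c χ′) (ℤP.+-identityʳ (χ′ c)))

  coeff-Φ*blockₚ : ∀ c d n → c ≤ d → coeff (Φ *ₚ blockₚ c d) n ≡ χ′ (suc n ∸ c) -ᶻ χ′ (suc n ∸ d)
  coeff-Φ*blockₚ c d n c≤d =
    trans (coeff-*ₚ-blockₚ Φ c d n c≤d) (cong₂ _-ᶻ_ (prefixSum-Φ (suc n ∸ c)) (prefixSum-Φ (suc n ∸ d)))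

  cofactor : Poly
  cofactor = blockₚ p (p + q) -ₚ blockₚ 0 q

  coeff-Φ*cofactor : ∀ n → coeff (Φ *ₚ cofactor) n ≡ δ (p * q) n -ᶻ δ 0 n
  coeff-Φ*cofactor n = begin
    coeff (Φ *ₚ cofactor) n
      ≡⟨ coeff-*ₚ-minusₚ Φ (blockₚ p (p + q)) (blockₚ 0 q) n ⟩
    coeff (Φ *ₚ blockₚ p (p + q)) n -ᶻ coeff (Φ *ₚ blockₚ 0 q) n
      ≡⟨ cong₂ _-ᶻ_ (coeff-Φ*blockₚ p (p + q) n (ℕP.m≤m+n p q)) (coeff-Φ*blockₚ 0 q n z≤n) ⟩
    (χ′ (suc n ∸ p) -ᶻ χ′ (suc n ∸ (p + q))) -ᶻ (χ′ (suc n) -ᶻ χ′ (suc n ∸ q))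
      ≡⟨ cong₂ _-ᶻ_ (trans (cong (λ c → χ′ (suc n ∸ p) -ᶻ χ′ c) (sym (ℕP.∸-+-assoc (suc n) p q)))
                           (χ′-∸q (suc n ∸ p)))
                    (χ′-∸q (suc n)) ⟩
    shiftₛ 1 multP (suc n ∸ p) -ᶻ multP n
      ≡⟨ multP-difference n ⟩
    δ (p * q) n -ᶻ δ 0 n
      ∎
    where
    open ≡-Reasoning
    multP-difference : ∀ n → shiftₛ 1 multP (suc n ∸ p) -ᶻ multP n ≡ δ (p * q) n -ᶻ δ 0 n
    multP-difference n with n ℕP.<? p
    ... | yes n<p rewrite ℕP.m≤n⇒m∸n≡0 n<p | multP-<p n n<p =
      cong (_-ᶻ δ 0 n) (sym (δ-≢ (p * q) n (λ pq≡n → ℕP.<⇒≱ n<p (ℕP.≤-trans (ℕP.m≤m*n p q) (ℕP.≤-reflexive pq≡n)))))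
    ... | no  n≮p = subst (λ n → shiftₛ 1 multP (suc n ∸ p) -ᶻ multP n ≡ δ (p * q) n -ᶻ δ 0 n)
                          (ℕP.m∸n+n≡m (ℕP.≮⇒≥ n≮p)) (at-+p (n ∸ p))
      where
      at-+p : ∀ m → shiftₛ 1 multP (suc (m + p) ∸ p) -ᶻ multP (m + p) ≡ δ (p * q) (m + p) -ᶻ δ 0 (m + p)
      at-+p m = begin
        shiftₛ 1 multP (suc m + p ∸ p) -ᶻ multP (m + p)
          ≡⟨ cong₂ _-ᶻ_ (cong (shiftₛ 1 multP) (ℕP.m+n∸n≡m (suc m) p)) (multP-+p m) ⟩
        multP m -ᶻ (multP m -ᶻ δ (q-1 * p) m)
          ≡⟨ cancel (multP m) (δ (q-1 * p) m) ⟩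
        δ (q-1 * p) m
          ≡⟨ sym (δpq-δ0-+p m) ⟩
        δ (p * q) (m + p) -ᶻ δ 0 (m + p)
          ∎
        where
        cancel : ∀ t d → t -ᶻ (t -ᶻ d) ≡ d
        cancel = solve-∀

  -- Reducing x^k modulo Φ_pq

  -- x^k ≡ G (mod Φ) with deg G < N, written without negative exponents:
  -- x^K - x^E G = Φ Q where K = k + E.
  record Reduction (k : ℤ) : Set where
    field
      E K        : ℕ
      Q          : Poly
      G          : ℕ → ℤ
      K≡k+E      : + K ≡ k +ᶻ + E
      G-vanishes : ∀ e → N ≤ e → G e ≡ 0ℤ
      G-101      : ∀ e → Is-101 (G e)
      Φ*Q≡       : ∀ n → coeff (Φ *ₚ Q) n ≡ δ K n -ᶻ shiftₛ E G n

  reduction : ∀ {k} E K Q → + K ≡ k +ᶻ + E →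
              (∀ n → n < E → coeff (Φ *ₚ Q) n ≡ δ K n) →
              (∀ e → N ≤ e → coeff (Φ *ₚ Q) (E + e) ≡ δ K (E + e)) →
              (∀ e → e < N → Is-101 (δ K (E + e) -ᶻ coeff (Φ *ₚ Q) (E + e))) →
              Reduction k
  reduction E K Q K≡k+E below-E beyond-N small = record
    { E = E ; K = K ; Q = Q ; G = G ; K≡k+E = K≡k+E
    ; G-vanishes = truncate-≥ N D
    ; G-101 = G-101
    ; Φ*Q≡ = split-at E _ below above }
    where
    D : ℕ → ℤ
    D e = δ K (E + e) -ᶻ coeff (Φ *ₚ Q) (E + e)
    G = truncate N D
    G-101 : ∀ e → Is-101 (G e)
    G-101 e with e ℕP.<? N
    ... | yes e<N = small e e<N
    ... | no  _   = inj₂ (inj₁ refl)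
    below : ∀ n → n < E → coeff (Φ *ₚ Q) n ≡ δ K n -ᶻ shiftₛ E G n
    below n n<E = trans (below-E n n<E)
                        (sym (trans (cong (λ g → δ K n -ᶻ g) (shiftₛ-< E G n n<E)) (ℤP.+-identityʳ (δ K n))))
    above : ∀ e → coeff (Φ *ₚ Q) (E + e) ≡ δ K (E + e) -ᶻ shiftₛ E G (E + e)
    above e rewrite shiftₛ-+ˡ E G e with e ℕP.<? N
    ... | yes e<N = sym (cancel (δ K (E + e)) (coeff (Φ *ₚ Q) (E + e)))
      where
      cancel : ∀ d c → d -ᶻ (d -ᶻ c) ≡ c
      cancel = solve-∀
    ... | no  e≮N = trans (beyond-N e (ℕP.≮⇒≥ e≮N)) (sym (ℤP.+-identityʳ (δ K (E + e))))

  r : ℕ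
  r = q-1 ∸ p-1

  q-1≡p-1+r : q-1 ≡ p-1 + r
  q-1≡p-1+r = sym (ℕP.m+[n∸m]≡n (ℕP.≤-trans (ℕP.n≤1+n p-1) (ℕP.≤-pred p<q)))

  [p-1]q≡N+p-1 : p-1 * q ≡ N + p-1
  [p-1]q≡N+p-1 = expand p-1 q-1
    where
    expand : ∀ p-1 q-1 → p-1 * (1 + q-1) ≡ p-1 * q-1 + p-1
    expand = ℕ-Solver.solve-∀

  [q-1]p≡[p-1]q+r : q-1 * p ≡ p-1 * q + r
  [q-1]p≡[p-1]q+r = subst (λ q-1 → q-1 * p ≡ p-1 * suc q-1 + r) (sym q-1≡p-1+r) (expand p-1 r)
    where
    expand : ∀ p-1 r → (p-1 + r) * (1 + p-1) ≡ p-1 * (1 + (p-1 + r)) + r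
    expand = ℕ-Solver.solve-∀

  [1+[p-2]q]+r≡N : suc (p-2 * q) + r ≡ N
  [1+[p-2]q]+r≡N = subst (λ q-1 → suc (p-2 * suc q-1) + r ≡ suc p-2 * q-1) (sym q-1≡p-1+r) (expand p-2 r)
    where
    expand : ∀ p-2 r → 1 + p-2 * (1 + (1 + p-2 + r)) + r ≡ (1 + p-2) * (1 + p-2 + r)
    expand = ℕ-Solver.solve-∀

  1+m+e∸m≡1+e : ∀ m e → suc (m + e) ∸ m ≡ suc e
  1+m+e∸m≡1+e m e = trans (cong (_∸ m) (sym (ℕP.+-suc m e))) (ℕP.m+n∸m≡n m (suc e))

  reduction-<N : ∀ b → b < N → Reduction (+ b)
  reduction-<N b b<N = reduction 0 b [] (sym (ℤP.+-identityʳ (+ b))) (λ _ ()) beyond-N small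
    where
    beyond-N : ∀ e → N ≤ e → coeff (Φ *ₚ []) e ≡ δ b e
    beyond-N e N≤e = trans (coeff-*ₚ-[] Φ e) (sym (δ-≢ b e (λ b≡e → ℕP.<⇒≱ b<N (subst (N ≤_) (sym b≡e) N≤e))))
    small : ∀ e → e < N → Is-101 (δ b e -ᶻ coeff (Φ *ₚ []) e)
    small e _ = subst Is-101 (cong (λ c → δ b e -ᶻ c) (sym (coeff-*ₚ-[] Φ e)))
                      (Is-101-difference (δ-01 b e) (inj₁ refl))

  reduction-negative : ∀ m → 0 < m → m ≤ p-1 → Reduction (-ᶻ + m)
  reduction-negative m@(suc _) _ m≤p-1 =
    reduction m 0 (blockₚ 0 m) (sym (ℤP.+-inverseˡ (+ m))) below-m beyond-N small
    where
    Φ*Q≡ : ∀ n → coeff (Φ *ₚ blockₚ 0 m) n ≡ χ n -ᶻ χ′ (suc n ∸ m)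
    Φ*Q≡ n = coeff-Φ*blockₚ 0 m n z≤n
    Φ*Q≡-+m : ∀ e → coeff (Φ *ₚ blockₚ 0 m) (m + e) ≡ χ (m + e) -ᶻ χ e
    Φ*Q≡-+m e = trans (Φ*Q≡ (m + e)) (cong (λ c → χ (m + e) -ᶻ χ′ c) (1+m+e∸m≡1+e m e))
    below-m : ∀ n → n < m → coeff (Φ *ₚ blockₚ 0 m) n ≡ δ 0 n
    below-m n n<m = begin
      coeff (Φ *ₚ blockₚ 0 m) n  ≡⟨ Φ*Q≡ n ⟩
      χ n -ᶻ χ′ (suc n ∸ m)      ≡⟨ cong (λ c → χ n -ᶻ χ′ c) (ℕP.m≤n⇒m∸n≡0 n<m) ⟩
      χ n -ᶻ 0ℤ                  ≡⟨ ℤP.+-identityʳ (χ n) ⟩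
      χ n                        ≡⟨ χ-below n n<m ⟩
      δ 0 n                      ∎
      where
      open ≡-Reasoning
      χ-below : ∀ n → n < m → χ n ≡ δ 0 n
      χ-below zero    _   = χ-0
      χ-below (suc n) n<m = χ-<p (suc n) (s≤s z≤n) (ℕP.≤-trans n<m (ℕP.m≤n⇒m≤1+n m≤p-1))
    beyond-N : ∀ e → N ≤ e → coeff (Φ *ₚ blockₚ 0 m) (m + e) ≡ δ 0 (m + e)
    beyond-N e N≤e = trans (Φ*Q≡-+m e)
      (trans (cong₂ _-ᶻ_ (χ-≥N (m + e) (ℕP.≤-trans N≤e (ℕP.m≤n+m e m))) (χ-≥N e N≤e)) (ℤP.+-inverseʳ 1ℤ))
    small : ∀ e → e < N → Is-101 (δ 0 (m + e) -ᶻ coeff (Φ *ₚ blockₚ 0 m) (m + e))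
    small e _ = subst Is-101 (trans (negate (χ (m + e)) (χ e)) (cong (λ c → 0ℤ -ᶻ c) (sym (Φ*Q≡-+m e))))
                      (Is-101-difference (χ-01 e) (χ-01 (m + e)))
      where
      negate : ∀ a b → b -ᶻ a ≡ 0ℤ -ᶻ (a -ᶻ b)
      negate = solve-∀

  χ′-late : ∀ n → N ≤ n → χ′ (suc n ∸ p) ≡ 1ℤ -ᶻ δ (p-1 * q) n
  χ′-late n N≤n = begin
    χ′ (suc n ∸ p)                         ≡⟨ sym (cancel (χ n) (χ′ (suc n ∸ p))) ⟩
    χ n -ᶻ (χ n -ᶻ χ′ (suc n ∸ p))          ≡⟨ cong₂ _-ᶻ_ (χ-≥N n N≤n) (trans (χ′-∸p (suc n)) (multQ-late n late)) ⟩
    1ℤ -ᶻ δ (p-1 * q) n                    ∎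
    where
    open ≡-Reasoning
    late : suc (p-2 * q) ≤ n
    late = ℕP.≤-trans (ℕP.≤-trans (ℕP.m≤m+n _ r) (ℕP.≤-reflexive [1+[p-2]q]+r≡N)) N≤n
    cancel : ∀ a b → a -ᶻ (a -ᶻ b) ≡ b
    cancel = solve-∀

  reduction-below-[p-1]q : ∀ m → 0 < m → m ≤ p-1 → Reduction (+ (p-1 * q ∸ m))
  reduction-below-[p-1]q m@(suc _) _ m≤p-1 =
    reduction m (p-1 * q) (blockₚ m p) (cong +_ (sym (ℕP.m∸n+n≡m m≤[p-1]q))) below-m beyond-N small
    where
    m≤p = ℕP.m≤n⇒m≤1+n m≤p-1
    m≤[p-1]q : m ≤ p-1 * q
    m≤[p-1]q = ℕP.≤-trans m≤p-1 (subst (p-1 ≤_) (sym [p-1]q≡N+p-1) (ℕP.m≤n+m p-1 N))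
    Φ*Q≡-+m : ∀ e → coeff (Φ *ₚ blockₚ m p) (m + e) ≡ χ e -ᶻ χ′ (suc (m + e) ∸ p)
    Φ*Q≡-+m e = trans (coeff-Φ*blockₚ m p (m + e) m≤p) (cong (λ c → χ′ c -ᶻ χ′ (suc (m + e) ∸ p)) (1+m+e∸m≡1+e m e))
    below-m : ∀ n → n < m → coeff (Φ *ₚ blockₚ m p) n ≡ δ (p-1 * q) n
    below-m n n<m = begin
      coeff (Φ *ₚ blockₚ m p) n              ≡⟨ coeff-Φ*blockₚ m p n m≤p ⟩
      χ′ (suc n ∸ m) -ᶻ χ′ (suc n ∸ p)       ≡⟨ cong₂ (λ c c′ → χ′ c -ᶻ χ′ c′) (ℕP.m≤n⇒m∸n≡0 n<m)
                                                     (ℕP.m≤n⇒m∸n≡0 (ℕP.≤-trans n<m m≤p)) ⟩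
      0ℤ                                     ≡⟨ sym (δ-≢ (p-1 * q) n [p-1]q≢n) ⟩
      δ (p-1 * q) n                          ∎
      where
      open ≡-Reasoning
      [p-1]q≢n : p-1 * q ≢ n
      [p-1]q≢n [p-1]q≡n = ℕP.<⇒≱ n<m (subst (m ≤_) [p-1]q≡n m≤[p-1]q)
    beyond-N : ∀ e → N ≤ e → coeff (Φ *ₚ blockₚ m p) (m + e) ≡ δ (p-1 * q) (m + e)
    beyond-N e N≤e = begin
      coeff (Φ *ₚ blockₚ m p) (m + e)      ≡⟨ Φ*Q≡-+m e ⟩
      χ e -ᶻ χ′ (suc (m + e) ∸ p)          ≡⟨ cong₂ _-ᶻ_ (χ-≥N e N≤e) (χ′-late (m + e) N≤m+e) ⟩
      1ℤ -ᶻ (1ℤ -ᶻ δ (p-1 * q) (m + e))    ≡⟨ cancel 1ℤ (δ (p-1 * q) (m + e)) ⟩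
      δ (p-1 * q) (m + e)                  ∎
      where
      open ≡-Reasoning
      N≤m+e = ℕP.≤-trans N≤e (ℕP.m≤n+m e m)
      cancel : ∀ a b → a -ᶻ (a -ᶻ b) ≡ b
      cancel = solve-∀
    [p-1]q≢m+e : ∀ e → e < N → p-1 * q ≢ m + e
    [p-1]q≢m+e e e<N eq = ℕP.<-irrefl (sym eq)
      (subst (m + e <_) (trans (ℕP.+-comm p-1 N) (sym [p-1]q≡N+p-1)) (ℕP.+-mono-≤-< m≤p-1 e<N))
    small : ∀ e → e < N → Is-101 (δ (p-1 * q) (m + e) -ᶻ coeff (Φ *ₚ blockₚ m p) (m + e))
    small e e<N = subst Is-101
      (trans (negate (χ e) (χ′ (suc (m + e) ∸ p)))
             (cong₂ _-ᶻ_ (sym (δ-≢ (p-1 * q) (m + e) ([p-1]q≢m+e e e<N))) (sym (Φ*Q≡-+m e))))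
      (Is-101-difference (χ′-01 (suc (m + e) ∸ p)) (χ-01 e))
      where
      negate : ∀ a b → b -ᶻ a ≡ 0ℤ -ᶻ (a -ᶻ b)
      negate = solve-∀

  reduction-above-[p-1]q : ∀ a → a ≤ r → Reduction (+ (p-1 * q + a))
  reduction-above-[p-1]q a a≤r =
    reduction 0 (p-1 * q + a) (blockₚ a (a + p)) (sym (ℤP.+-identityʳ _)) (λ _ ()) beyond-N small
    where
    L : ℕ → ℤ
    L n = coeff (Φ *ₚ blockₚ a (a + p)) n
    L≡ : ∀ n → L n ≡ χ′ (suc n ∸ a) -ᶻ χ′ (suc n ∸ (a + p))
    L≡ n = coeff-Φ*blockₚ a (a + p) n (ℕP.m≤m+n a p)
    L-below : ∀ n → n < a → L n ≡ 0ℤ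
    L-below n n<a = trans (L≡ n) (cong₂ (λ c c′ → χ′ c -ᶻ χ′ c′) (ℕP.m≤n⇒m∸n≡0 n<a)
                                       (ℕP.m≤n⇒m∸n≡0 (ℕP.≤-trans n<a (ℕP.m≤m+n a p))))
    L-+a : ∀ j → L (a + j) ≡ multQ j
    L-+a j = trans (L≡ (a + j)) (trans (cong₂ (λ c c′ → χ′ c -ᶻ χ′ c′) (1+m+e∸m≡1+e a j) ∸[a+p]) (χ′-∸p (suc j)))
      where
      ∸[a+p] : suc (a + j) ∸ (a + p) ≡ suc j ∸ p
      ∸[a+p] = trans (sym (ℕP.∸-+-assoc (suc (a + j)) a p)) (cong (_∸ p) (1+m+e∸m≡1+e a j))
    L-01 : ∀ n → Is01 (L n)
    L-01 = split-at a (λ n → Is01 (L n)) (λ n n<a → inj₁ (L-below n n<a))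
                                         (λ j → subst Is01 (sym (L-+a j)) (multQ-01 j))
    N≤[p-1]q+a : N ≤ p-1 * q + a
    N≤[p-1]q+a = ℕP.≤-trans (ℕP.≤-trans (ℕP.m≤m+n N p-1) (ℕP.≤-reflexive (sym [p-1]q≡N+p-1))) (ℕP.m≤m+n _ a)
    beyond-N : ∀ e → N ≤ e → L e ≡ δ (p-1 * q + a) e
    beyond-N e N≤e = subst (λ e → L e ≡ δ (p-1 * q + a) e) (ℕP.m+[n∸m]≡n a≤e) (begin
      L (a + (e ∸ a))                       ≡⟨ L-+a (e ∸ a) ⟩
      multQ (e ∸ a)                         ≡⟨ multQ-late (e ∸ a) late ⟩
      δ (p-1 * q) (e ∸ a)                   ≡⟨ sym (δ-+ʳ (p-1 * q) (e ∸ a) a) ⟩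
      δ (p-1 * q + a) (e ∸ a + a)           ≡⟨ cong (δ (p-1 * q + a)) (ℕP.+-comm (e ∸ a) a) ⟩
      δ (p-1 * q + a) (a + (e ∸ a))         ∎)
      where
      open ≡-Reasoning
      r≤N : r ≤ N
      r≤N = subst (r ≤_) [1+[p-2]q]+r≡N (ℕP.m≤n+m r _)
      a≤e = ℕP.≤-trans a≤r (ℕP.≤-trans r≤N N≤e)
      late : suc (p-2 * q) ≤ e ∸ a
      late = ℕP.m+n≤o⇒m≤o∸n _ (ℕP.≤-trans (ℕP.+-monoʳ-≤ (suc (p-2 * q)) a≤r)
                                          (ℕP.≤-trans (ℕP.≤-reflexive [1+[p-2]q]+r≡N) N≤e))
    small : ∀ e → e < N → Is-101 (δ (p-1 * q + a) e -ᶻ L e)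
    small e e<N = subst Is-101
      (cong (_-ᶻ L e) (sym (δ-≢ (p-1 * q + a) e (λ eq → ℕP.<⇒≱ e<N (subst (N ≤_) eq N≤[p-1]q+a)))))
      (Is-101-difference (inj₁ refl) (L-01 e))

  coeff-Φ*shiftₚ-cofactor : ∀ K n → coeff (Φ *ₚ shiftₚ K cofactor) n ≡ δ (K + p * q) n -ᶻ δ K n
  coeff-Φ*shiftₚ-cofactor K n = begin
    coeff (Φ *ₚ shiftₚ K cofactor) n                 ≡⟨ coeff-*ₚ-shiftₚ Φ K cofactor n ⟩
    shiftₛ K (coeff (Φ *ₚ cofactor)) n                ≡⟨ shiftₛ-cong K coeff-Φ*cofactor n ⟩
    shiftₛ K (λ i → δ (p * q) i -ᶻ δ 0 i) n           ≡⟨ shiftₛ-minus K (δ (p * q)) (δ 0) n ⟩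
    shiftₛ K (δ (p * q)) n -ᶻ shiftₛ K (δ 0) n        ≡⟨ cong₂ _-ᶻ_ (shiftₛ-δ K (p * q) n) (shiftₛ-δ K 0 n) ⟩
    δ (K + p * q) n -ᶻ δ (K + 0) n                   ≡⟨ cong (λ a → δ (K + p * q) n -ᶻ δ a n) (ℕP.+-identityʳ K) ⟩
    δ (K + p * q) n -ᶻ δ K n                         ∎
    where open ≡-Reasoning

  reduction-plus-pq : ∀ {k} → Reduction k → Reduction (k +ᶻ + (p * q))
  reduction-plus-pq {k} ρ = record
    { E = E ; K = K + p * q ; Q = Q +ₚ shiftₚ K cofactor ; G = G
    ; K≡k+E = trans (cong (_+ᶻ + (p * q)) K≡k+E) (swap k (+ E) (+ (p * q)))
    ; G-vanishes = G-vanishes ; G-101 = G-101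
    ; Φ*Q≡ = λ n → begin
        coeff (Φ *ₚ (Q +ₚ shiftₚ K cofactor)) n
          ≡⟨ coeff-*ₚ-+ₚ Φ Q (shiftₚ K cofactor) n ⟩
        coeff (Φ *ₚ Q) n +ᶻ coeff (Φ *ₚ shiftₚ K cofactor) n
          ≡⟨ cong₂ _+ᶻ_ (Φ*Q≡ n) (coeff-Φ*shiftₚ-cofactor K n) ⟩
        δ K n -ᶻ shiftₛ E G n +ᶻ (δ (K + p * q) n -ᶻ δ K n)
          ≡⟨ cancel (δ K n) (shiftₛ E G n) (δ (K + p * q) n) ⟩
        δ (K + p * q) n -ᶻ shiftₛ E G n
          ∎ }
    where
    open Reduction ρ
    open ≡-Reasoning
    swap : ∀ a b c → a +ᶻ b +ᶻ c ≡ a +ᶻ c +ᶻ b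
    swap = solve-∀
    cancel : ∀ a g b → a -ᶻ g +ᶻ (b -ᶻ a) ≡ b -ᶻ g
    cancel = solve-∀

  reduction-minus-pq : ∀ {k} → Reduction k → Reduction (k -ᶻ + (p * q))
  reduction-minus-pq {k} ρ = record
    { E = p * q + E ; K = K ; Q = shiftₚ (p * q) Q -ₚ shiftₚ K cofactor ; G = G
    ; K≡k+E = trans K≡k+E (regroup k (+ E) (+ (p * q)))
    ; G-vanishes = G-vanishes ; G-101 = G-101
    ; Φ*Q≡ = λ n → begin
        coeff (Φ *ₚ (shiftₚ (p * q) Q -ₚ shiftₚ K cofactor)) n
          ≡⟨ coeff-*ₚ-minusₚ Φ (shiftₚ (p * q) Q) (shiftₚ K cofactor) n ⟩
        coeff (Φ *ₚ shiftₚ (p * q) Q) n -ᶻ coeff (Φ *ₚ shiftₚ K cofactor) n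
          ≡⟨ cong₂ _-ᶻ_ (trans (coeff-*ₚ-shiftₚ Φ (p * q) Q n) (shifted-Φ*Q n)) (coeff-Φ*shiftₚ-cofactor K n) ⟩
        δ (K + p * q) n -ᶻ shiftₛ (p * q + E) G n -ᶻ (δ (K + p * q) n -ᶻ δ K n)
          ≡⟨ cancel (δ (K + p * q) n) (shiftₛ (p * q + E) G n) (δ K n) ⟩
        δ K n -ᶻ shiftₛ (p * q + E) G n
          ∎ }
    where
    open Reduction ρ
    open ≡-Reasoning
    shifted-Φ*Q : ∀ n → shiftₛ (p * q) (coeff (Φ *ₚ Q)) n ≡ δ (K + p * q) n -ᶻ shiftₛ (p * q + E) G n
    shifted-Φ*Q n = begin
      shiftₛ (p * q) (coeff (Φ *ₚ Q)) n                   ≡⟨ shiftₛ-cong (p * q) Φ*Q≡ n ⟩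
      shiftₛ (p * q) (λ i → δ K i -ᶻ shiftₛ E G i) n       ≡⟨ shiftₛ-δ-shiftₛ (p * q) K E G n ⟩
      δ (p * q + K) n -ᶻ shiftₛ (p * q + E) G n
        ≡⟨ cong (λ a → δ a n -ᶻ shiftₛ (p * q + E) G n) (ℕP.+-comm (p * q) K) ⟩
      δ (K + p * q) n -ᶻ shiftₛ (p * q + E) G n           ∎
    regroup : ∀ a e c → a +ᶻ e ≡ a -ᶻ c +ᶻ (c +ᶻ e)
    regroup = solve-∀
    cancel : ∀ b g a → b -ᶻ g -ᶻ (b -ᶻ a) ≡ a -ᶻ g
    cancel = solve-∀

  reduction-plus-multiple : ∀ {k} d → Reduction k → Reduction (k +ᶻ d *ᶻ + (p * q))
  reduction-plus-multiple {k} d ρ = subst Reduction (cong (k +ᶻ_) (ℤP.*-comm (+ (p * q)) d)) (by d)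
    where
    x = + (p * q)
    times-0 : ∀ k x → k +ᶻ x *ᶻ 0ℤ ≡ k
    times-0 = solve-∀
    times-suc : ∀ k x y → k +ᶻ x *ᶻ y +ᶻ x ≡ k +ᶻ x *ᶻ (1ℤ +ᶻ y)
    times-suc = solve-∀
    times-pred : ∀ k x y → k +ᶻ x *ᶻ (-ᶻ y) -ᶻ x ≡ k +ᶻ x *ᶻ (-ᶻ (1ℤ +ᶻ y))
    times-pred = solve-∀
    up : ∀ j → Reduction (k +ᶻ x *ᶻ + j)
    up zero    = subst Reduction (sym (times-0 k x)) ρ
    up (suc j) = subst Reduction (times-suc k x (+ j)) (reduction-plus-pq (up j))
    down : ∀ j → Reduction (k +ᶻ x *ᶻ -ᶻ + j)
    down zero    = subst Reduction (sym (times-0 k x)) ρ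
    down (suc j) = subst Reduction (times-pred k x (+ j)) (reduction-minus-pq (down j))
    by : ∀ d → Reduction (k +ᶻ x *ᶻ d)
    by (+ j)      = up j
    by -[1+ j ]   = down (suc j)

  reduction-<pq : ∀ b → b < p * q → Reduction (+ b)
  reduction-<pq b b<pq with b ℕP.<? N | b ℕP.<? p-1 * q | b ℕP.≤? q-1 * p
  ... | yes b<N | _            | _ = reduction-<N b b<N
  ... | no  b≮N | yes b<[p-1]q | _ =
    subst (λ b → Reduction (+ b)) (ℕP.m∸[m∸n]≡n (ℕP.<⇒≤ b<[p-1]q))
          (reduction-below-[p-1]q (p-1 * q ∸ b) (ℕP.m<n⇒0<n∸m b<[p-1]q) (ℕP.m≤n+o⇒m∸n≤o (p-1 * q) b [p-1]q≤b+p-1))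
    where
    [p-1]q≤b+p-1 : p-1 * q ≤ b + p-1
    [p-1]q≤b+p-1 = ℕP.≤-trans (ℕP.≤-reflexive [p-1]q≡N+p-1) (ℕP.+-monoˡ-≤ p-1 (ℕP.≮⇒≥ b≮N))
  ... | no  b≮N | no b≮[p-1]q  | yes b≤[q-1]p =
    subst (λ b → Reduction (+ b)) (ℕP.m+[n∸m]≡n (ℕP.≮⇒≥ b≮[p-1]q))
          (reduction-above-[p-1]q (b ∸ p-1 * q)
            (ℕP.m≤n+o⇒m∸n≤o b (p-1 * q) (ℕP.≤-trans b≤[q-1]p (ℕP.≤-reflexive [q-1]p≡[p-1]q+r))))
  ... | no  b≮N | no b≮[p-1]q  | no b≰[q-1]p =
    subst Reduction -[pq∸b]+pq≡b
          (reduction-plus-pq (reduction-negative (p * q ∸ b) (ℕP.m<n⇒0<n∸m b<pq) (ℕP.m≤n+o⇒m∸n≤o (p * q) b pq≤b+p-1)))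
    where
    pq≤b+p-1 : p * q ≤ b + p-1
    pq≤b+p-1 = begin
      p * q           ≡⟨ pq≡[q-1]p+p ⟩
      q-1 * p + p     ≡⟨ ℕP.+-suc (q-1 * p) p-1 ⟩
      suc (q-1 * p) + p-1 ≤⟨ ℕP.+-monoˡ-≤ p-1 (ℕP.≰⇒> b≰[q-1]p) ⟩
      b + p-1         ∎
      where open ℕP.≤-Reasoning
    -[pq∸b]+pq≡b : -ᶻ + (p * q ∸ b) +ᶻ + (p * q) ≡ + b
    -[pq∸b]+pq≡b = begin
      -ᶻ + (p * q ∸ b) +ᶻ + (p * q) ≡⟨ ℤP.+-comm (-ᶻ + (p * q ∸ b)) (+ (p * q)) ⟩
      + (p * q) -ᶻ + (p * q ∸ b)    ≡⟨ ℤP.m-n≡m⊖n (p * q) (p * q ∸ b) ⟩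
      p * q ℤ.⊖ (p * q ∸ b)        ≡⟨ ℤP.⊖-≥ (ℕP.m∸n≤m (p * q) b) ⟩
      + (p * q ∸ (p * q ∸ b))       ≡⟨ cong +_ (ℕP.m∸[m∸n]≡n (ℕP.<⇒≤ b<pq)) ⟩
      + b                           ∎
      where open ≡-Reasoning

  reduction-all : ∀ k → Reduction k
  reduction-all k = subst Reduction (sym (a≡a%ℕn+[a/ℕn]*n k (p * q)))
    (reduction-plus-multiple (k /ℕ (p * q)) (reduction-<pq (k %ℕ (p * q)) (n%ℕd<d k (p * q))))

  Reduction⇒∣L : ∀ {k} (ρ : Reduction k) → let open Reduction ρ in
                 polyL Φ ∣L (xpow k -L polyL (toList (tabulateℕ N G)))
  Reduction⇒∣L {k} ρ with xpow-monomial k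
  ... | j , j≡k+m , coeff-f = (E , Q) , λ i → begin
    coeff (shiftₚ E (shiftₚ 0 f -ₚ shiftₚ m g)) i
      ≡⟨ coeff-shiftₚ E _ i ⟩
    shiftₛ E (coeff (shiftₚ 0 f -ₚ shiftₚ m g)) i
      ≡⟨ shiftₛ-cong E (λ t → trans (coeff-minusₚ f (shiftₚ m g) t)
                        (cong₂ _-ᶻ_ (coeff-f t) (trans (coeff-shiftₚ m g t) (shiftₛ-cong m coeff-g t)))) i ⟩
    shiftₛ E (λ t → δ j t -ᶻ shiftₛ m G t) i
      ≡⟨ shiftₛ-δ-shiftₛ E j m G i ⟩
    δ (E + j) i -ᶻ shiftₛ (E + m) G i
      ≡⟨ cong₂ (λ a b → δ a i -ᶻ shiftₛ b G i) E+j≡m+0+K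
               (trans (ℕP.+-comm E m) (cong (_+ E) (sym (ℕP.+-identityʳ m)))) ⟩
    δ (m + 0 + K) i -ᶻ shiftₛ (m + 0 + E) G i
      ≡⟨ sym (shiftₛ-δ-shiftₛ (m + 0) K E G i) ⟩
    shiftₛ (m + 0) (λ t → δ K t -ᶻ shiftₛ E G t) i
      ≡⟨ sym (trans (coeff-shiftₚ (m + 0) (Φ *ₚ Q) i) (shiftₛ-cong (m + 0) Φ*Q≡ i)) ⟩
    coeff (shiftₚ (m + 0) (Φ *ₚ Q)) i
      ∎
    where
    open Reduction ρ
    open ≡-Reasoning
    m = proj₁ (xpow k)
    f = proj₂ (xpow k)
    g = toList (tabulateℕ N G)
    coeff-g : ∀ e → coeff g e ≡ G e
    coeff-g e with e ℕP.<? N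
    ... | yes e<N = coeff-tabulateℕ-< N G e e<N
    ... | no  e≮N = trans (coeff-tabulateℕ-≥ N G e (ℕP.≮⇒≥ e≮N)) (sym (G-vanishes e (ℕP.≮⇒≥ e≮N)))
    E+j≡m+0+K : E + j ≡ m + 0 + K
    E+j≡m+0+K = ℤP.+-injective (begin
      + E +ᶻ + j           ≡⟨ cong (+ E +ᶻ_) j≡k+m ⟩
      + E +ᶻ (k +ᶻ + m)     ≡⟨ regroup (+ E) k (+ m) ⟩
      + m +ᶻ 0ℤ +ᶻ (k +ᶻ + E) ≡⟨ cong (+ m +ᶻ 0ℤ +ᶻ_) (sym K≡k+E) ⟩
      + m +ᶻ 0ℤ +ᶻ + K      ∎)
      where
      regroup : ∀ e k m → e +ᶻ (k +ᶻ m) ≡ m +ᶻ 0ℤ +ᶻ (k +ᶻ e)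
      regroup = solve-∀

lemma8p3 : (p q : ℕ) → Prime p → Prime q → p < q → (k : ℤ) →
    Σ (Vec ℤ ((p ∸ 1) * (q ∸ 1))) (λ g →
      All (λ c → c ≡ -1ℤ ⊎ c ≡ 0ℤ ⊎ c ≡ 1ℤ) g ×
      (polyL (Φpq p q) ∣L (xpow k -L polyL (toList g))))
lemma8p3 zero                q          p-prime _       _   k = ⊥-elim (¬prime[0] p-prime)
lemma8p3 (suc zero)          q          p-prime _       _   k = ⊥-elim (¬prime[1] p-prime)
lemma8p3 (suc (suc p-2))     (suc q-1)  _       q-prime p<q k =
  tabulateℕ N G , All-tabulateℕ N G G-101 , Reduction⇒∣L ρ
  where
  open Cyclotomic p-2 q-1 p<q q-prime
  ρ = reduction-all k
  open Reduction ρ
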